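{- For each $n\geq 1$, the Tutte polynomial of the Schreier graph $\Gamma_n$ of the Grigorchuk group is $$T(\Gamma_n;x,y) = y^{2^n+4}\, x^{2^{n-1}}\, (y+x)^{2^{n-1}-1}.$$
   Context: Let $X^n$ denote the set of binary words of length $n$ over $\{0,1\}$. The Grigorchuk group is generated by the automorphisms $a,b,c,d$ of the rooted binary tree defined recursively on finite binary words $w$ by $a(0w)=1w$, $a(1w)=0w$, $b(0w)=0a(w)$, $b(1w)=1c(w)$, $c(0w)=0a(w)$, $c(1w)=1d(w)$, $d(0w)=0w$, $d(1w)=1b(w)$ (all fix the empty word); each generator is an involution. For $n\geq1$, the Schreier graph $\Gamma_n$ is the finite multigraph with vertex set $X^n$ having, for each $s\in\{a,b,c,d\}$ and each orbit $\{u,s(u)\}$ of $s$ on $X^n$, one edge joining $u$ and $s(u)$ (a loop when $s(u)=u$). (As an unlabelled multigraph, $\Gamma_n$ has vertices $v_1,\dots,v_{2^n}$ arranged on a line, a single edge between $v_{2k-1}$ and $v_{2k}$ for $1\le k\le 2^{n-1}$, two parallel edges between $v_{2k}$ and $v_{2k+1}$ for $1\le k\le 2^{n-1}-1$, one loop at each of $v_2,\dots,v_{2^n-1}$ and three loops at each of $v_1,v_{2^n}$.) For a finite multigraph $G=(V,E)$ (loops and multiple edges allowed), the Tutte polynomial is $T(G;x,y)=\sum_{A\subseteq E}(x-1)^{r(E)-r(A)}(y-1)^{|A|-r(A)}$, where $r(A)=|V|-k(A)$ and $k(A)$ is the number of connected components of the spanning subgraph $(V,A)$. -}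

module Defs where

open import Data.Bool using (Bool; true; false; if_then_else_; _∨_; _∧_; not)
import Data.Bool as B
open import Data.Nat using (ℕ; zero; suc; _∸_)
open import Data.Integer using (ℤ; _-_; _*_; _+_; _^_; +_; 1ℤ)
open import Data.List using (List; []; _∷_; map; _++_; length; concatMap; filter; foldr)
open import Data.Product using (_×_; _,_; proj₁; proj₂)
open import Data.Vec using (Vec; []; _∷_)
open import Data.Vec.Properties using (≡-dec)
open import Relation.Binary.Definitions using (DecidableEquality)
open import Relation.Nullary.Decidable using (does)

-- Binary words and the Grigorchuk group generators
-- Convention: false = letter 0, true = letter 1.

Word : ℕ → Set
Word n = Vec Bool n

data Gen : Set where
  a b c d : Gen

gens : List Gen
gens = a ∷ b ∷ c ∷ d ∷ []

act : Gen → ∀ {n} → Word n → Word n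
act _ [] = []
act a (false ∷ w) = true ∷ w
act a (true  ∷ w) = false ∷ w
act b (false ∷ w) = false ∷ act a w
act b (true  ∷ w) = true  ∷ act c w
act c (false ∷ w) = false ∷ act a w
act c (true  ∷ w) = true  ∷ act d w
act d (false ∷ w) = false ∷ w
act d (true  ∷ w) = true  ∷ act b w

allWords : (n : ℕ) → List (Word n)
allWords zero = [] ∷ []
allWords (suc n) = map (false ∷_) (allWords n) ++ map (true ∷_) (allWords n)

_≟W_ : ∀ {n} → DecidableEquality (Word n)
_≟W_ = ≡-dec B._≟_

-- lexicographic "less than or equal" on words (used to pick one
-- representative (u , s u) per orbit {u , s u})
leqW : ∀ {n} → Word n → Word n → Bool
leqW [] [] = true
leqW (false ∷ u) (true ∷ v) = true
leqW (true ∷ u) (false ∷ v) = false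
leqW (false ∷ u) (false ∷ v) = leqW u v
leqW (true ∷ u) (true ∷ v) = leqW u v

-- Finite multigraphs: vertex list and edge list (loops and parallel
-- edges allowed; edges are distinguished by their position in the list)

record Multigraph : Set₁ where
  field
    V        : Set
    _≟V_     : DecidableEquality V
    vertices : List V
    edges    : List (V × V)

open Multigraph public

-- Schreier graph Γ_n: for each generator s and each orbit {u , s u} of s
-- on X^n, one edge joining u and s u (a loop if s u = u).
schreier : ℕ → Multigraph
schreier n = record
  { V = Word n
  ; _≟V_ = _≟W_
  ; vertices = allWords n
  ; edges = concatMap (λ s → map (λ u → u , act s u)
                         (filter (λ u → B.T? (leqW u (act s u))) (allWords n)))
                      gens
  }

module _ {V : Set} (_≟_ : DecidableEquality V) where

  elem : V → List V → Bool
  elem x [] = false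
  elem x (y ∷ ys) = does (x ≟ y) ∨ elem x ys

  extract : V → List (List V) → List V × List (List V)
  extract x [] = (x ∷ []) , []
  extract x (B ∷ Bs) with elem x B
  ... | true  = B , Bs
  ... | false = let r = extract x Bs in proj₁ r , B ∷ proj₂ r

  addEdge : V × V → List (List V) → List (List V)
  addEdge (u , w) P =
    let r₁ = extract u P in
    if elem w (proj₁ r₁) then P
    else (let r₂ = extract w (proj₂ r₁) in (proj₁ r₁ ++ proj₁ r₂) ∷ proj₂ r₂)

  components : List V → List (V × V) → ℕ
  components vs A = length (foldr addEdge (map (λ v → v ∷ []) vs) A)

kComp : (G : Multigraph) → List (V G × V G) → ℕ
kComp G A = components (_≟V_ G) (vertices G) A

rank : (G : Multigraph) → List (V G × V G) → ℕ
rank G A = length (vertices G) ∸ kComp G A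

subsets : {X : Set} → List X → List (List X)
subsets [] = [] ∷ []
subsets (e ∷ es) = map (e ∷_) (subsets es) ++ subsets es

tutte : Multigraph → ℤ → ℤ → ℤ
tutte G x y =
  foldr _+_ (+ 0) (map (λ A → ((x - 1ℤ) ^ (rank G (edges G) ∸ rank G A))
                 * ((y - 1ℤ) ^ (length A ∸ rank G A)))
           (subsets (edges G)))

-- Order the words of X^n along a path by pos (a reflected binary order).  Every edge of Γ_n is
-- then a loop or joins two consecutive positions j and j + 1, and the self-similarity
-- b(0w) = 0a(w), b(1w) = 1c(w), … shows by induction on n that there are 2^n + 4 loops, one edge
-- at every even j and two parallel edges at every odd j < 2^n - 1.  The union–find computation
-- of the components keeps, as an invariant, that two words share a block iff their positions are
-- joined by the chosen edges, so the rank of an edge set is the number of positions it covers.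
-- The subset expansion then factorises over positions: each loop contributes y, a single edge x
-- and a double edge x + y.
module Submission where

open import Data.Bool using (Bool; true; false; if_then_else_; _∨_; _∧_; not)
import Data.Bool as Bool
import Data.Bool.Properties as Boolₚ
open import Data.Bool.Solver using (module ∨-∧-Solver)
open import Data.Empty using (⊥-elim)
open import Data.Integer as ℤ using (ℤ; 0ℤ; 1ℤ)
import Data.Integer.Properties as ℤₚ
open import Data.Integer.Tactic.RingSolver using () renaming (solve-∀ to solve-ℤ)
open import Data.List using (List; []; _∷_; map; _++_; length; foldr; filter)
import Data.List.Properties as Listₚ
open import Data.List.Relation.Unary.All as All using (All; []; _∷_)
import Data.List.Relation.Unary.All.Properties as Allₚ
open import Data.Maybe using (Maybe; just; nothing)
import Data.Maybe.Relation.Unary.All as Maybe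
open import Data.Nat
open import Data.Nat.Properties
open import Data.Nat.Tactic.RingSolver using () renaming (solve-∀ to solve-ℕ)
open import Algebra.Properties.CommutativeSemigroup +-commutativeSemigroup using (x∙yz≈y∙xz; xy∙z≈xz∙y)
import Algebra.Properties.CommutativeSemigroup ℤₚ.*-commutativeSemigroup as ℤ*
open import Data.Product using (Σ; _×_; _,_; proj₁; proj₂; uncurry)
open import Data.Vec using ([]; _∷_)
open import Function using (_∘_)
open import Relation.Binary.Definitions using (DecidableEquality)
open import Relation.Binary.PropositionalEquality
open import Relation.Nullary using (does; yes; no; contradiction)

open import Defs

toℕ : Bool → ℕ
toℕ true = 1
toℕ false = 0

toℕ≤1 : ∀ b → toℕ b ≤ 1
toℕ≤1 true = s≤s z≤n
toℕ≤1 false = z≤n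

toℕ-injective : ∀ {p q} → toℕ p ≡ toℕ q → p ≡ q
toℕ-injective {true} {true} _ = refl
toℕ-injective {false} {false} _ = refl

≡ᵇ-refl : ∀ k → (k ≡ᵇ k) ≡ true
≡ᵇ-refl zero = refl
≡ᵇ-refl (suc k) = ≡ᵇ-refl k

≢⇒≡ᵇ-false : ∀ {k j} → k ≢ j → (k ≡ᵇ j) ≡ false
≢⇒≡ᵇ-false {zero} {zero} k≢j = ⊥-elim (k≢j refl)
≢⇒≡ᵇ-false {zero} {suc j} _ = refl
≢⇒≡ᵇ-false {suc k} {zero} _ = refl
≢⇒≡ᵇ-false {suc k} {suc j} k≢j = ≢⇒≡ᵇ-false (k≢j ∘ cong suc)

≡ᵇ-true⇒≡ : ∀ {k j} → (k ≡ᵇ j) ≡ true → k ≡ j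
≡ᵇ-true⇒≡ {k} {j} e = ≡ᵇ⇒≡ k j (subst Bool.T (sym e) _)

≡ᵇ-sym : ∀ m n → (m ≡ᵇ n) ≡ (n ≡ᵇ m)
≡ᵇ-sym zero zero = refl
≡ᵇ-sym zero (suc n) = refl
≡ᵇ-sym (suc m) zero = refl
≡ᵇ-sym (suc m) (suc n) = ≡ᵇ-sym m n

toℕ-∨ : ∀ p q → p ∧ q ≡ false → toℕ p + toℕ q ≡ toℕ (p ∨ q)
toℕ-∨ true true ()
toℕ-∨ true false _ = refl
toℕ-∨ false q _ = refl

∧-∨-expand : ∀ p q r s → (p ∨ q) ∧ (r ∨ s) ≡ (((p ∧ r) ∨ (q ∧ s)) ∨ (p ∧ s)) ∨ (q ∧ r)
∧-∨-expand = solve 4 (λ p q r s → (p :+ q) :* (r :+ s) := (((p :* r) :+ (q :* s)) :+ (p :* s)) :+ (q :* r)) refl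
  where open ∨-∧-Solver

count : {A : Set} → (A → Bool) → List A → ℕ
count p [] = 0
count p (x ∷ xs) = toℕ (p x) + count p xs

count-++ : {A : Set} (p : A → Bool) (xs ys : List A) → count p (xs ++ ys) ≡ count p xs + count p ys
count-++ p [] ys = refl
count-++ p (x ∷ xs) ys = trans (cong (toℕ (p x) +_) (count-++ p xs ys)) (sym (+-assoc (toℕ (p x)) _ _))

count-map : {A B : Set} (p : B → Bool) (f : A → B) (xs : List A) → count p (map f xs) ≡ count (p ∘ f) xs
count-map p f [] = refl
count-map p f (x ∷ xs) = cong (toℕ (p (f x)) +_) (count-map p f xs)

count-cong : {A : Set} {p q : A → Bool} → (∀ x → p x ≡ q x) → ∀ xs → count p xs ≡ count q xs
count-cong p≗q [] = refl
count-cong p≗q (x ∷ xs) = cong₂ _+_ (cong toℕ (p≗q x)) (count-cong p≗q xs)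

count-none : {A : Set} (xs : List A) → count (λ _ → false) xs ≡ 0
count-none [] = refl
count-none (x ∷ xs) = count-none xs

count-all : {A : Set} (xs : List A) → count (λ _ → true) xs ≡ length xs
count-all [] = refl
count-all (x ∷ xs) = cong suc (count-all xs)

count-merge : {A : Set} {p q r : A → Bool} → (∀ x → toℕ (p x) + toℕ (q x) ≡ toℕ (r x)) →
  ∀ xs → count p xs + count q xs ≡ count r xs
count-merge pq≡r [] = refl
count-merge {p = p} {q} {r} pq≡r (x ∷ xs) = begin
  toℕ (p x) + count p xs + (toℕ (q x) + count q xs)  ≡⟨ +-assoc (toℕ (p x)) _ _ ⟩
  toℕ (p x) + (count p xs + (toℕ (q x) + count q xs))
    ≡⟨ cong (toℕ (p x) +_) (x∙yz≈y∙xz (count p xs) (toℕ (q x)) (count q xs)) ⟩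
  toℕ (p x) + (toℕ (q x) + (count p xs + count q xs)) ≡⟨ sym (+-assoc (toℕ (p x)) _ _) ⟩
  toℕ (p x) + toℕ (q x) + (count p xs + count q xs)   ≡⟨ cong₂ _+_ (pq≡r x) (count-merge pq≡r xs) ⟩
  toℕ (r x) + count r xs                               ∎
  where open ≡-Reasoning

sumOver : {A : Set} → List A → (A → ℤ) → ℤ
sumOver xs f = foldr ℤ._+_ 0ℤ (map f xs)

sumOver-++ : {A : Set} (xs ys : List A) (f : A → ℤ) →
  sumOver (xs ++ ys) f ≡ sumOver xs f ℤ.+ sumOver ys f
sumOver-++ [] ys f = sym (ℤₚ.+-identityˡ _)
sumOver-++ (x ∷ xs) ys f =
  trans (cong (ℤ._+_ (f x)) (sumOver-++ xs ys f)) (sym (ℤₚ.+-assoc (f x) _ _))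

sumOver-map : {A B : Set} (g : A → B) (xs : List A) (f : B → ℤ) →
  sumOver (map g xs) f ≡ sumOver xs (f ∘ g)
sumOver-map g xs f = cong (foldr ℤ._+_ 0ℤ) (sym (Listₚ.map-∘ xs))

sumOver-*ˡ : {A : Set} (xs : List A) (r : ℤ) (f : A → ℤ) →
  sumOver xs (λ x → r ℤ.* f x) ≡ r ℤ.* sumOver xs f
sumOver-*ˡ [] r f = sym (ℤₚ.*-zeroʳ r)
sumOver-*ˡ (x ∷ xs) r f =
  trans (cong (ℤ._+_ (r ℤ.* f x)) (sumOver-*ˡ xs r f)) (sym (ℤₚ.*-distribˡ-+ r (f x) _))

sumOver-cong : {A : Set} (xs : List A) {f g : A → ℤ} → (∀ x → f x ≡ g x) → sumOver xs f ≡ sumOver xs g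
sumOver-cong xs f≗g = cong (foldr ℤ._+_ 0ℤ) (Listₚ.map-cong f≗g xs)

sumOver-cong-All : {A : Set} {P : A → Set} {xs : List A} (f g : A → ℤ) →
  All P xs → (∀ {x} → P x → f x ≡ g x) → sumOver xs f ≡ sumOver xs g
sumOver-cong-All f g [] f≗g = refl
sumOver-cong-All f g (px ∷ pxs) f≗g = cong₂ ℤ._+_ (f≗g px) (sumOver-cong-All f g pxs f≗g)

sumOver-subsets-∷ : {A : Set} (x : A) (xs : List A) (f : List A → ℤ) →
  sumOver (subsets (x ∷ xs)) f ≡ sumOver (subsets xs) (f ∘ (x ∷_)) ℤ.+ sumOver (subsets xs) f
sumOver-subsets-∷ x xs f =
  trans (sumOver-++ (map (x ∷_) (subsets xs)) (subsets xs) f)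
        (cong (ℤ._+ sumOver (subsets xs) f) (sumOver-map (x ∷_) (subsets xs) f))

All-subsets : {A : Set} {P : A → Set} {xs : List A} → All P xs → All (All P) (subsets xs)
All-subsets [] = [] ∷ []
All-subsets (px ∷ pxs) =
  Allₚ.++⁺ (Allₚ.map⁺ (All.map (px ∷_) (All-subsets pxs))) (All-subsets pxs)

subsets-map : {A B : Set} (f : A → B) (xs : List A) → subsets (map f xs) ≡ map (map f) (subsets xs)
subsets-map f [] = refl
subsets-map f (x ∷ xs) = begin
  map (f x ∷_) (subsets (map f xs)) ++ subsets (map f xs)
    ≡⟨ cong (λ S → map (f x ∷_) S ++ S) (subsets-map f xs) ⟩
  map (f x ∷_) (map (map f) (subsets xs)) ++ map (map f) (subsets xs)
    ≡⟨ cong (_++ map (map f) (subsets xs)) (trans (sym (Listₚ.map-∘ (subsets xs))) (Listₚ.map-∘ (subsets xs))) ⟩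
  map (map f) (map (x ∷_) (subsets xs)) ++ map (map f) (subsets xs)
    ≡⟨ sym (Listₚ.map-++ (map f) (map (x ∷_) (subsets xs)) (subsets xs)) ⟩
  map (map f) (map (x ∷_) (subsets xs) ++ subsets xs) ∎
  where open ≡-Reasoning

-- Spanning subgraphs of a path with multiple edges and loops

-- nothing is a loop and just j an edge between the positions j and suc j
Label : Set
Label = Maybe ℕ

isLoop : Label → Bool
isLoop nothing = true
isLoop (just _) = false

isEdge : ℕ → Label → Bool
isEdge k nothing = false
isEdge k (just j) = k ≡ᵇ j

loops : List Label → ℕ
loops = count isLoop

multiplicity : ℕ → List Label → ℕ
multiplicity k = count (isEdge k)

insert : ℕ → (ℕ → Bool) → ℕ → Bool
insert j C k = C k ∨ (k ≡ᵇ j)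

product< : ℕ → (ℕ → ℤ) → ℤ
product< zero h = 1ℤ
product< (suc m) h = product< m h ℤ.* h m

product<-cong : ∀ m {h h′ : ℕ → ℤ} → (∀ {k} → k < m → h k ≡ h′ k) → product< m h ≡ product< m h′
product<-cong zero h≗h′ = refl
product<-cong (suc m) h≗h′ = cong₂ ℤ._*_ (product<-cong m (h≗h′ ∘ m<n⇒m<1+n)) (h≗h′ (n<1+n m))

product<-linear : ∀ {m j} → j < m → (α : ℤ) (f g h : ℕ → ℤ) →
  (∀ {k} → k ≢ j → f k ≡ h k) → (∀ {k} → k ≢ j → g k ≡ h k) →
  α ℤ.* f j ℤ.+ g j ≡ h j → α ℤ.* product< m f ℤ.+ product< m g ≡ product< m h
product<-linear {suc m} {j} j<1+m α f g h f≈h g≈h at-j with j ≟ m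
... | yes refl = begin
  α ℤ.* (product< m f ℤ.* f j) ℤ.+ product< m g ℤ.* g j
    ≡⟨ cong₂ (λ F G → α ℤ.* (F ℤ.* f j) ℤ.+ G ℤ.* g j)
             (product<-cong m (λ k<m → f≈h (<⇒≢ k<m))) (product<-cong m (λ k<m → g≈h (<⇒≢ k<m))) ⟩
  α ℤ.* (product< m h ℤ.* f j) ℤ.+ product< m h ℤ.* g j
    ≡⟨ factor-out α (product< m h) (f j) (g j) ⟩
  product< m h ℤ.* (α ℤ.* f j ℤ.+ g j)
    ≡⟨ cong (product< m h ℤ.*_) at-j ⟩
  product< m h ℤ.* h j ∎
  where
  open ≡-Reasoning
  factor-out : ∀ α P x y → α ℤ.* (P ℤ.* x) ℤ.+ P ℤ.* y ≡ P ℤ.* (α ℤ.* x ℤ.+ y)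
  factor-out = solve-ℤ
... | no j≢m = begin
  α ℤ.* (product< m f ℤ.* f m) ℤ.+ product< m g ℤ.* g m
    ≡⟨ cong₂ (λ F G → α ℤ.* (product< m f ℤ.* F) ℤ.+ product< m g ℤ.* G) (f≈h (j≢m ∘ sym)) (g≈h (j≢m ∘ sym)) ⟩
  α ℤ.* (product< m f ℤ.* h m) ℤ.+ product< m g ℤ.* h m
    ≡⟨ factor-out α (product< m f) (product< m g) (h m) ⟩
  (α ℤ.* product< m f ℤ.+ product< m g) ℤ.* h m
    ≡⟨ cong (ℤ._* h m) (product<-linear (≤∧≢⇒< (≤-pred j<1+m) j≢m) α f g h f≈h g≈h at-j) ⟩
  product< m h ℤ.* h m ∎
  where
  open ≡-Reasoning
  factor-out : ∀ α F G z → α ℤ.* (F ℤ.* z) ℤ.+ G ℤ.* z ≡ (α ℤ.* F ℤ.+ G) ℤ.* z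
  factor-out = solve-ℤ

_∪_ : (ℕ → Bool) → (ℕ → Bool) → ℕ → Bool
(C ∪ D) k = C k ∨ D k

covers : List Label → ℕ → Bool
covers [] k = false
covers (nothing ∷ B) k = covers B k
covers (just j ∷ B) k = (k ≡ᵇ j) ∨ covers B k

∪-covers-covered : ∀ {j} C B → C j ≡ true → ∀ k → (C ∪ covers (just j ∷ B)) k ≡ (C ∪ covers B) k
∪-covers-covered {j} C B Cj k with k ≡ᵇ j in k≡j
... | false = refl
... | true = trans (Boolₚ.∨-zeroʳ (C k)) (sym (cong (_∨ covers B k) (trans (cong C (≡ᵇ-true⇒≡ k≡j)) Cj)))

∪-covers-∷ : ∀ j C B k → (C ∪ covers (just j ∷ B)) k ≡ (insert j C ∪ covers B) k
∪-covers-∷ j C B k = sym (Boolₚ.∨-assoc (C k) (k ≡ᵇ j) (covers B k))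

covers-multiplicity : ∀ k ℓ → 1 ≤ multiplicity k ℓ → covers ℓ k ≡ true
covers-multiplicity k (nothing ∷ ℓ) k∈ℓ = covers-multiplicity k ℓ k∈ℓ
covers-multiplicity k (just j ∷ ℓ) k∈ℓ with k ≡ᵇ j
... | true = refl
... | false = covers-multiplicity k ℓ k∈ℓ

count< : ℕ → (ℕ → Bool) → ℕ
count< zero C = 0
count< (suc m) C = count< m C + toℕ (C m)

count<-cong : ∀ m {C D : ℕ → Bool} → (∀ k → C k ≡ D k) → count< m C ≡ count< m D
count<-cong zero C≗D = refl
count<-cong (suc m) C≗D = cong₂ _+_ (count<-cong m C≗D) (cong toℕ (C≗D m))

count<≤ : ∀ m C → count< m C ≤ m
count<≤ zero C = z≤n
count<≤ (suc m) C = ≤-trans (+-mono-≤ (count<≤ m C) (toℕ≤1 (C m))) (≤-reflexive (+-comm m 1))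

count<-empty : ∀ m → count< m (λ _ → false) ≡ 0
count<-empty zero = refl
count<-empty (suc m) = cong (_+ 0) (count<-empty m)

count<-full : ∀ m C → (∀ {k} → k < m → C k ≡ true) → count< m C ≡ m
count<-full zero C full = refl
count<-full (suc m) C full =
  trans (cong₂ _+_ (count<-full m C (full ∘ m<n⇒m<1+n)) (cong toℕ (full (n<1+n m)))) (+-comm m 1)

count<-insert-beyond : ∀ m {j} C → m ≤ j → count< m (insert j C) ≡ count< m C
count<-insert-beyond zero C m≤j = refl
count<-insert-beyond (suc m) {j} C m<j
  rewrite count<-insert-beyond m C (≤-trans (n≤1+n m) m<j)
        | ≢⇒≡ᵇ-false (<⇒≢ m<j) | Boolₚ.∨-identityʳ (C m) = refl

count<-insert : ∀ m {j} C → j < m → count< m (insert j C) ≡ count< m C + toℕ (not (C j))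
count<-insert (suc m) {j} C j<1+m with j ≟ m
... | yes refl rewrite count<-insert-beyond m C (≤-refl {m}) | ≡ᵇ-refl m with C m
...   | true = sym (+-identityʳ _)
...   | false = cong (_+ 1) (sym (+-identityʳ _))
count<-insert (suc m) {j} C j<1+m | no j≢m
  rewrite count<-insert m C (≤∧≢⇒< (≤-pred j<1+m) j≢m)
        | ≢⇒≡ᵇ-false (j≢m ∘ sym) | Boolₚ.∨-identityʳ (C m) = xy∙z≈xz∙y (count< m C) _ _

count<-insert≤ : ∀ m j C → count< m (insert j C) ≤ suc (count< m C)
count<-insert≤ m j C with j <? m
... | yes j<m = ≤-trans (≤-reflexive (trans (count<-insert m C j<m) (+-comm _ (toℕ (not (C j))))))
                        (+-monoˡ-≤ (count< m C) (toℕ≤1 (not (C j))))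
... | no j≮m = ≤-trans (≤-reflexive (count<-insert-beyond m C (≮⇒≥ j≮m))) (n≤1+n _)

count<-∪-covers≤ : ∀ m B C → count< m (C ∪ covers B) ≤ length B + count< m C
count<-∪-covers≤ m [] C = ≤-reflexive (count<-cong m (λ k → Boolₚ.∨-identityʳ (C k)))
count<-∪-covers≤ m (nothing ∷ B) C = m≤n⇒m≤1+n (count<-∪-covers≤ m B C)
count<-∪-covers≤ m (just j ∷ B) C = begin
  count< m (C ∪ covers (just j ∷ B))       ≡⟨ count<-cong m (∪-covers-∷ j C B) ⟩
  count< m (insert j C ∪ covers B)         ≤⟨ count<-∪-covers≤ m B (insert j C) ⟩
  length B + count< m (insert j C)         ≤⟨ +-monoʳ-≤ (length B) (count<-insert≤ m j C) ⟩
  length B + suc (count< m C)              ≡⟨ +-suc (length B) (count< m C) ⟩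
  suc (length B + count< m C)              ∎
  where open ≤-Reasoning

module PathExpansion (m : ℕ) (X Y : ℤ) where

  -- The Tutte summand of B when the positions in C are already covered: a loop or an edge at a
  -- covered position raises the nullity (a factor Y), any other edge covers its position and so
  -- removes a factor X.
  weight : List Label → (ℕ → Bool) → ℤ
  weight [] C = product< m (λ k → if C k then 1ℤ else X)
  weight (nothing ∷ B) C = Y ℤ.* weight B C
  weight (just j ∷ B) C = if C j then Y ℤ.* weight B C else weight B (insert j C)

  -- With X = x - 1 and Y = y - 1, bundle e = x + y + ⋯ + y ^ (e - 1) for e ≥ 1:
  -- the Tutte polynomial of a bundle of e parallel edges.
  bundle : ℕ → ℤ
  bundle zero = X
  bundle (suc e) = bundle e ℤ.+ (1ℤ ℤ.+ Y) ℤ.^ e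

  factor : Bool → ℕ → ℤ
  factor true e = (1ℤ ℤ.+ Y) ℤ.^ e
  factor false e = bundle e

  closedForm : List Label → (ℕ → Bool) → ℤ
  closedForm ℓ C = (1ℤ ℤ.+ Y) ℤ.^ loops ℓ ℤ.* product< m (λ k → factor (C k) (multiplicity k ℓ))

  private
    factor-elsewhere : ∀ {j k} (C : ℕ → Bool) ℓ → k ≢ j →
      factor (C k) (multiplicity k ℓ) ≡ factor (C k) (multiplicity k (just j ∷ ℓ))
    factor-elsewhere {j} {k} C ℓ k≢j rewrite ≢⇒≡ᵇ-false k≢j = refl

    multiplicity-here : ∀ j ℓ → multiplicity j (just j ∷ ℓ) ≡ suc (multiplicity j ℓ)
    multiplicity-here j ℓ rewrite ≡ᵇ-refl j = refl

  subsets-weight : ∀ ℓ → All (Maybe.All (_< m)) ℓ → ∀ C →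
    sumOver (subsets ℓ) (λ B → weight B C) ≡ closedForm ℓ C
  subsets-weight [] [] C =
    trans (ℤₚ.+-identityʳ (weight [] C))
          (trans (product<-cong m (λ {k} _ → empty k)) (sym (ℤₚ.*-identityˡ (product< m (λ k → factor (C k) 0)))))
    where
    empty : ∀ k → (if C k then 1ℤ else X) ≡ factor (C k) 0
    empty k with C k
    ... | true = refl
    ... | false = refl
  subsets-weight (nothing ∷ ℓ) (_ ∷ ℓ<m) C = begin
    sumOver (subsets (nothing ∷ ℓ)) (λ B → weight B C)
      ≡⟨ sumOver-subsets-∷ nothing ℓ (λ B → weight B C) ⟩
    sumOver (subsets ℓ) (λ B → Y ℤ.* weight B C) ℤ.+ sumOver (subsets ℓ) (λ B → weight B C)
      ≡⟨ cong (ℤ._+ sumOver (subsets ℓ) (λ B → weight B C)) (sumOver-*ˡ (subsets ℓ) Y (λ B → weight B C)) ⟩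
    Y ℤ.* sumOver (subsets ℓ) (λ B → weight B C) ℤ.+ sumOver (subsets ℓ) (λ B → weight B C)
      ≡⟨ cong (λ S → Y ℤ.* S ℤ.+ S) (subsets-weight ℓ ℓ<m C) ⟩
    Y ℤ.* closedForm ℓ C ℤ.+ closedForm ℓ C
      ≡⟨ one-more-loop Y ((1ℤ ℤ.+ Y) ℤ.^ loops ℓ) _ ⟩
    closedForm (nothing ∷ ℓ) C ∎
    where
    open ≡-Reasoning
    one-more-loop : ∀ Y L P → Y ℤ.* (L ℤ.* P) ℤ.+ L ℤ.* P ≡ ((1ℤ ℤ.+ Y) ℤ.* L) ℤ.* P
    one-more-loop = solve-ℤ
  subsets-weight (just j ∷ ℓ) (Maybe.just j<m ∷ ℓ<m) C with C j in Cj
  ... | true = begin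
    sumOver (subsets (just j ∷ ℓ)) (λ B → weight B C)
      ≡⟨ sumOver-subsets-∷ (just j) ℓ (λ B → weight B C) ⟩
    sumOver (subsets ℓ) (λ B → weight (just j ∷ B) C) ℤ.+ sumOver (subsets ℓ) (λ B → weight B C)
      ≡⟨ cong (ℤ._+ sumOver (subsets ℓ) (λ B → weight B C))
              (trans (sumOver-cong (subsets ℓ) (λ B → cong (branch B) Cj))
                     (sumOver-*ˡ (subsets ℓ) Y (λ B → weight B C))) ⟩
    Y ℤ.* sumOver (subsets ℓ) (λ B → weight B C) ℤ.+ sumOver (subsets ℓ) (λ B → weight B C)
      ≡⟨ cong (λ S → Y ℤ.* S ℤ.+ S) (subsets-weight ℓ ℓ<m C) ⟩
    Y ℤ.* (L ℤ.* Π C) ℤ.+ L ℤ.* Π C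
      ≡⟨ factor-out Y L (Π C) (Π C) ⟩
    L ℤ.* (Y ℤ.* Π C ℤ.+ Π C)
      ≡⟨ cong (L ℤ.*_) (product<-linear j<m Y _ _ _ (factor-elsewhere C ℓ) (factor-elsewhere C ℓ) at-j) ⟩
    closedForm (just j ∷ ℓ) C ∎
    where
    open ≡-Reasoning
    branch : List Label → Bool → ℤ
    branch B o = if o then Y ℤ.* weight B C else weight B (insert j C)
    L : ℤ
    L = (1ℤ ℤ.+ Y) ℤ.^ loops ℓ
    Π : (ℕ → Bool) → ℤ
    Π D = product< m (λ k → factor (D k) (multiplicity k ℓ))
    factor-out : ∀ Y L P Q → Y ℤ.* (L ℤ.* P) ℤ.+ L ℤ.* Q ≡ L ℤ.* (Y ℤ.* P ℤ.+ Q)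
    factor-out = solve-ℤ
    at-j : Y ℤ.* factor (C j) (multiplicity j ℓ) ℤ.+ factor (C j) (multiplicity j ℓ)
         ≡ factor (C j) (multiplicity j (just j ∷ ℓ))
    at-j = trans (cong (λ o → Y ℤ.* factor o e ℤ.+ factor o e) Cj)
                 (trans (one-more-edge Y ((1ℤ ℤ.+ Y) ℤ.^ e)) (sym (cong₂ factor Cj (multiplicity-here j ℓ))))
      where
      e = multiplicity j ℓ
      one-more-edge : ∀ Y P → Y ℤ.* P ℤ.+ P ≡ (1ℤ ℤ.+ Y) ℤ.* P
      one-more-edge = solve-ℤ
  ... | false = begin
    sumOver (subsets (just j ∷ ℓ)) (λ B → weight B C)
      ≡⟨ sumOver-subsets-∷ (just j) ℓ (λ B → weight B C) ⟩
    sumOver (subsets ℓ) (λ B → weight (just j ∷ B) C) ℤ.+ sumOver (subsets ℓ) (λ B → weight B C)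
      ≡⟨ cong (ℤ._+ sumOver (subsets ℓ) (λ B → weight B C)) (sumOver-cong (subsets ℓ) (λ B → cong (branch B) Cj)) ⟩
    sumOver (subsets ℓ) (λ B → weight B (insert j C)) ℤ.+ sumOver (subsets ℓ) (λ B → weight B C)
      ≡⟨ cong₂ ℤ._+_ (subsets-weight ℓ ℓ<m (insert j C)) (subsets-weight ℓ ℓ<m C) ⟩
    L ℤ.* Π (insert j C) ℤ.+ L ℤ.* Π C
      ≡⟨ factor-out L (Π (insert j C)) (Π C) ⟩
    L ℤ.* (1ℤ ℤ.* Π (insert j C) ℤ.+ Π C)
      ≡⟨ cong (L ℤ.*_) (product<-linear j<m 1ℤ _ _ _ inserted-elsewhere (factor-elsewhere C ℓ) at-j) ⟩
    closedForm (just j ∷ ℓ) C ∎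
    where
    open ≡-Reasoning
    branch : List Label → Bool → ℤ
    branch B o = if o then Y ℤ.* weight B C else weight B (insert j C)
    L : ℤ
    L = (1ℤ ℤ.+ Y) ℤ.^ loops ℓ
    Π : (ℕ → Bool) → ℤ
    Π D = product< m (λ k → factor (D k) (multiplicity k ℓ))
    factor-out : ∀ L P Q → L ℤ.* P ℤ.+ L ℤ.* Q ≡ L ℤ.* (1ℤ ℤ.* P ℤ.+ Q)
    factor-out = solve-ℤ
    inserted-elsewhere : ∀ {k} → k ≢ j →
      factor (insert j C k) (multiplicity k ℓ) ≡ factor (C k) (multiplicity k (just j ∷ ℓ))
    inserted-elsewhere {k} k≢j rewrite ≢⇒≡ᵇ-false k≢j | Boolₚ.∨-identityʳ (C k) = refl
    at-j : 1ℤ ℤ.* factor (insert j C j) (multiplicity j ℓ) ℤ.+ factor (C j) (multiplicity j ℓ)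
         ≡ factor (C j) (multiplicity j (just j ∷ ℓ))
    at-j = begin
      1ℤ ℤ.* factor (insert j C j) e ℤ.+ factor (C j) e
        ≡⟨ cong₂ (λ p q → 1ℤ ℤ.* factor p e ℤ.+ factor q e) (cong (C j ∨_) (≡ᵇ-refl j)) Cj ⟩
      1ℤ ℤ.* factor (C j ∨ true) e ℤ.+ bundle e
        ≡⟨ cong (λ p → 1ℤ ℤ.* factor p e ℤ.+ bundle e) (Boolₚ.∨-zeroʳ (C j)) ⟩
      1ℤ ℤ.* (1ℤ ℤ.+ Y) ℤ.^ e ℤ.+ bundle e
        ≡⟨ trans (cong (ℤ._+ bundle e) (ℤₚ.*-identityˡ P)) (ℤₚ.+-comm P (bundle e)) ⟩
      bundle (suc e)
        ≡⟨ sym (cong₂ factor Cj (multiplicity-here j ℓ)) ⟩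
      factor (C j) (multiplicity j (just j ∷ ℓ)) ∎
      where
      e = multiplicity j ℓ
      P = (1ℤ ℤ.+ Y) ℤ.^ e

  private
    product<-weights : ∀ m′ C → product< m′ (λ k → if C k then 1ℤ else X) ≡ X ℤ.^ (m′ ∸ count< m′ C)
    product<-weights zero C = refl
    product<-weights (suc m′) C with C m′
    ... | true rewrite product<-weights m′ C | +-comm (count< m′ C) 1 = ℤₚ.*-identityʳ _
    ... | false rewrite product<-weights m′ C | +-identityʳ (count< m′ C) | +-∸-assoc 1 (count<≤ m′ C) =
      ℤₚ.*-comm _ X

  weight-closed : ∀ B → All (Maybe.All (_< m)) B → ∀ C →
    weight B C ≡ X ℤ.^ (m ∸ count< m (C ∪ covers B))
                 ℤ.* Y ℤ.^ ((length B + count< m C) ∸ count< m (C ∪ covers B))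
  weight-closed [] [] C
    rewrite count<-cong m (λ k → Boolₚ.∨-identityʳ (C k)) | n∸n≡0 (count< m C) =
    trans (product<-weights m C) (sym (ℤₚ.*-identityʳ _))
  weight-closed (nothing ∷ B) (_ ∷ B<m) C
    rewrite weight-closed B B<m C | +-∸-assoc 1 (count<-∪-covers≤ m B C) =
    ℤ*.x∙yz≈y∙xz Y (X ℤ.^ (m ∸ count< m (C ∪ covers B))) _
  weight-closed (just j ∷ B) (Maybe.just j<m ∷ B<m) C with C j in Cj
  ... | true
    rewrite weight-closed B B<m C
          | count<-cong m (∪-covers-covered C B Cj)
          | +-∸-assoc 1 (count<-∪-covers≤ m B C) =
    ℤ*.x∙yz≈y∙xz Y (X ℤ.^ (m ∸ count< m (C ∪ covers B))) _
  ... | false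
    rewrite weight-closed B B<m (insert j C)
          | count<-cong m (∪-covers-∷ j C B)
          | count<-insert m C j<m | Cj | +-comm (count< m C) 1 | +-suc (length B) (count< m C) = refl

link : {V : Set} → (V → V → Bool) → V → V → V → V → Bool
link R u w y z = (R y z ∨ (R y u ∧ R z w)) ∨ (R y w ∧ R z u)

link-swap : {V : Set} (R : V → V → Bool) (u w y z : V) → link R u w y z ≡ link R w u y z
link-swap R u w y z = solve 5 (λ p q r s t → (p :+ (q :* r)) :+ (s :* t) := (p :+ (s :* t)) :+ (q :* r)) refl
  (R y z) (R y u) (R z w) (R y w) (R z u)
  where open ∨-∧-Solver

-- The least vertex in the component of p, in the path on ℕ whose edge {k, suc k} is present iff C k.
leftmost : (ℕ → Bool) → ℕ → ℕ
leftmost C zero = zero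
leftmost C (suc p) = if C p then leftmost C p else suc p

connected : (ℕ → Bool) → ℕ → ℕ → Bool
connected C p q = leftmost C p ≡ᵇ leftmost C q

leftmost-empty : ∀ p → leftmost (λ _ → false) p ≡ p
leftmost-empty zero = refl
leftmost-empty (suc p) = refl

leftmost≤ : ∀ C p → leftmost C p ≤ p
leftmost≤ C zero = z≤n
leftmost≤ C (suc p) with C p
... | true = m≤n⇒m≤1+n (leftmost≤ C p)
... | false = ≤-refl

leftmost-cong : ∀ {C D} → (∀ k → C k ≡ D k) → ∀ p → leftmost C p ≡ leftmost D p
leftmost-cong C≗D zero = refl
leftmost-cong C≗D (suc p) rewrite C≗D p | leftmost-cong C≗D p = refl

connected-cong : ∀ {C D} → (∀ k → C k ≡ D k) → ∀ p q → connected C p q ≡ connected D p q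
connected-cong C≗D p q = cong₂ _≡ᵇ_ (leftmost-cong C≗D p) (leftmost-cong C≗D q)

redirect : ℕ → ℕ → ℕ → ℕ
redirect s r x = if x ≡ᵇ s then r else x

redirect-≡ᵇ : ∀ r s x y → (redirect s r x ≡ᵇ redirect s r y) ≡ link _≡ᵇ_ r s x y
redirect-≡ᵇ r s x y with x ≟ s | y ≟ s
... | yes refl | yes refl rewrite ≡ᵇ-refl x | ≡ᵇ-refl r = refl
... | yes refl | no y≢s rewrite ≡ᵇ-refl x | ≢⇒≡ᵇ-false y≢s | ≢⇒≡ᵇ-false (y≢s ∘ sym) =
  trans (≡ᵇ-sym r y) (sym (cong (_∨ (y ≡ᵇ r)) (Boolₚ.∧-zeroʳ (x ≡ᵇ r))))
... | no x≢s | yes refl rewrite ≡ᵇ-refl y | ≢⇒≡ᵇ-false x≢s =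
  sym (trans (Boolₚ.∨-identityʳ _) (Boolₚ.∧-identityʳ (x ≡ᵇ r)))
... | no x≢s | no y≢s rewrite ≢⇒≡ᵇ-false x≢s | ≢⇒≡ᵇ-false y≢s =
  sym (trans (Boolₚ.∨-identityʳ _) (trans (cong ((x ≡ᵇ y) ∨_) (Boolₚ.∧-zeroʳ (x ≡ᵇ r))) (Boolₚ.∨-identityʳ _)))

module _ {C : ℕ → Bool} {j : ℕ} (Cj : C j ≡ false) where

  leftmost-insert : ∀ p → leftmost (insert j C) p ≡ redirect (suc j) (leftmost C j) (leftmost C p)
  leftmost-insert zero = refl
  leftmost-insert (suc p) with p ≟ j
  ... | yes refl rewrite Cj | ≡ᵇ-refl p | leftmost-insert p
                       | ≢⇒≡ᵇ-false (<⇒≢ (s≤s (leftmost≤ C p))) = refl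
  ... | no p≢j rewrite ≢⇒≡ᵇ-false p≢j | Boolₚ.∨-identityʳ (C p) with C p
  ...   | true = leftmost-insert p
  ...   | false rewrite ≢⇒≡ᵇ-false p≢j = refl

  connected-insert : ∀ p q → connected (insert j C) p q ≡ link (connected C) j (suc j) p q
  connected-insert p q rewrite leftmost-insert p | leftmost-insert q | Cj =
    redirect-≡ᵇ (leftmost C j) (suc j) (leftmost C p) (leftmost C q)

-- The union–find computation of components

module UnionFind {V : Set} (_≟_ : DecidableEquality V) where

  _∈ᵇ_ : V → List V → Bool
  x ∈ᵇ B = elem _≟_ x B

  ∈ᵇ-++ : ∀ x B B′ → x ∈ᵇ (B ++ B′) ≡ x ∈ᵇ B ∨ x ∈ᵇ B′
  ∈ᵇ-++ x [] B′ = refl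
  ∈ᵇ-++ x (v ∷ B) B′ = trans (cong (does (x ≟ v) ∨_) (∈ᵇ-++ x B B′)) (sym (Boolₚ.∨-assoc (does (x ≟ v)) _ _))

  shared : V → V → List (List V) → ℕ
  shared y z [] = 0
  shared y z (B ∷ P) = toℕ (y ∈ᵇ B ∧ z ∈ᵇ B) + shared y z P

  shared-++ : ∀ y z P Q → shared y z (P ++ Q) ≡ shared y z P + shared y z Q
  shared-++ y z [] Q = refl
  shared-++ y z (B ∷ P) Q =
    trans (cong (toℕ (y ∈ᵇ B ∧ z ∈ᵇ B) +_) (shared-++ y z P Q)) (sym (+-assoc (toℕ (y ∈ᵇ B ∧ z ∈ᵇ B)) _ _))

  shared-sym : ∀ y z P → shared y z P ≡ shared z y P
  shared-sym y z [] = refl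
  shared-sym y z (B ∷ P) = cong₂ _+_ (cong toℕ (Boolₚ.∧-comm (y ∈ᵇ B) (z ∈ᵇ B))) (shared-sym y z P)

  shared≤shared-self : ∀ y z P → shared y z P ≤ shared z z P
  shared≤shared-self y z [] = z≤n
  shared≤shared-self y z (B ∷ P) = +-mono-≤ (toℕ-∧≤ (y ∈ᵇ B) (z ∈ᵇ B)) (shared≤shared-self y z P)
    where
    toℕ-∧≤ : ∀ p q → toℕ (p ∧ q) ≤ toℕ (q ∧ q)
    toℕ-∧≤ true true = ≤-refl
    toℕ-∧≤ true false = z≤n
    toℕ-∧≤ false q = z≤n

  -- Since R will be reflexive, this says that every vertex lies in exactly one block,
  -- and that two vertices share a block exactly when they are related by R.
  record _Represents_ (P : List (List V)) (R : V → V → Bool) : Set where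
    constructor represents
    field shared≡ : ∀ y z → shared y z P ≡ toℕ (R y z)
  open _Represents_ public

  record Extraction (x : V) (P : List (List V)) (B : List V) (Rest : List (List V)) : Set where
    field
      x∈B : x ∈ᵇ B ≡ true
      length-split : length P ≡ suc (length Rest)
      shared-split : ∀ y z → shared y z P ≡ toℕ (y ∈ᵇ B ∧ z ∈ᵇ B) + shared y z Rest

  extract-correct : ∀ x P → 1 ≤ shared x x P →
    Extraction x P (proj₁ (extract _≟_ x P)) (proj₂ (extract _≟_ x P))
  extract-correct x [] ()
  extract-correct x (B ∷ P) x∈P with elem _≟_ x B in x∈B
  ... | true = record { x∈B = x∈B ; length-split = refl ; shared-split = λ y z → refl }
  ... | false = record
    { x∈B = x∈B′
    ; length-split = cong suc length-split
    ; shared-split = λ y z →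
        trans (cong (toℕ (y ∈ᵇ B ∧ z ∈ᵇ B) +_) (shared-split y z))
              (x∙yz≈y∙xz (toℕ (y ∈ᵇ B ∧ z ∈ᵇ B)) (toℕ (y ∈ᵇ B′ ∧ z ∈ᵇ B′)) (shared y z Rest′))
    }
    where
    B′ = proj₁ (extract _≟_ x P)
    Rest′ = proj₂ (extract _≟_ x P)
    open Extraction (extract-correct x P x∈P) renaming (x∈B to x∈B′)

  extract-members : ∀ x P (x-once : shared x x P ≡ 1) y →
    toℕ (y ∈ᵇ proj₁ (extract _≟_ x P)) ≡ shared y x P
  extract-members x P x-once y = begin
    toℕ (y ∈ᵇ B)                            ≡⟨ cong toℕ (sym (trans (cong (y ∈ᵇ B ∧_) x∈B) (Boolₚ.∧-identityʳ _))) ⟩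
    toℕ (y ∈ᵇ B ∧ x ∈ᵇ B)                   ≡⟨ sym (+-identityʳ _) ⟩
    toℕ (y ∈ᵇ B ∧ x ∈ᵇ B) + 0               ≡⟨ cong (toℕ (y ∈ᵇ B ∧ x ∈ᵇ B) +_) (sym (n≤0⇒n≡0 y-x-in-Rest)) ⟩
    toℕ (y ∈ᵇ B ∧ x ∈ᵇ B) + shared y x Rest ≡⟨ sym (shared-split y x) ⟩
    shared y x P                             ∎
    where
    open ≡-Reasoning
    B = proj₁ (extract _≟_ x P)
    Rest = proj₂ (extract _≟_ x P)
    open Extraction (extract-correct x P (≤-reflexive (sym x-once)))
    x-not-in-Rest : shared x x Rest ≡ 0
    x-not-in-Rest = suc-injective (trans (cong (λ o → toℕ (o ∧ o) + shared x x Rest) (sym x∈B))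
                                         (trans (sym (shared-split x x)) x-once))
    y-x-in-Rest : shared y x Rest ≤ 0
    y-x-in-Rest = ≤-trans (shared≤shared-self y x Rest) (≤-reflexive x-not-in-Rest)

  private
    both-absent : ∀ p q {r} → toℕ p + (toℕ q + suc r) ≡ 1 → p ≡ false × q ≡ false
    both-absent false false _ = refl , refl
    both-absent false true ()
    both-absent true false ()
    both-absent true true ()

    not-both : ∀ p q {r} → toℕ p + (toℕ q + r) ≡ 1 → p ∧ q ≡ false
    not-both false q _ = refl
    not-both true false _ = refl
    not-both true true ()

    ∧-disjoint : ∀ p q r s → p ∧ q ≡ false → (p ∧ r) ∧ (q ∧ s) ≡ false
    ∧-disjoint false q r s _ = refl
    ∧-disjoint true false r s _ = Boolₚ.∧-zeroʳ r

    -- y lies in the block b₁ of u, the block b₂ of w or one of the remaining s′ blocks;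
    -- z is in the blocks c₁, c₂ likewise, and y and z share s of the remaining blocks.
    merge-count : ∀ b₁ b₂ c₁ c₂ t s {s′} → toℕ b₁ + (toℕ b₂ + s′) ≡ 1 → s ≤ s′ →
      toℕ (b₁ ∧ c₁) + (toℕ (b₂ ∧ c₂) + s) ≡ toℕ t →
      toℕ ((b₁ ∨ b₂) ∧ (c₁ ∨ c₂)) + s ≡ toℕ ((t ∨ (b₁ ∧ c₂)) ∨ (b₂ ∧ c₁))
    merge-count b₁ b₂ c₁ c₂ t zero y-once _ shared-yz =
      trans (+-identityʳ _) (cong toℕ (trans (∧-∨-expand b₁ b₂ c₁ c₂)
                                             (cong (λ t′ → (t′ ∨ (b₁ ∧ c₂)) ∨ (b₂ ∧ c₁)) (sym t≡))))
      where
      t≡ : t ≡ (b₁ ∧ c₁) ∨ (b₂ ∧ c₂)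
      t≡ = toℕ-injective (trans (sym shared-yz) (trans (cong (toℕ (b₁ ∧ c₁) +_) (+-identityʳ _))
             (toℕ-∨ (b₁ ∧ c₁) (b₂ ∧ c₂) (∧-disjoint b₁ b₂ c₁ c₂ (not-both b₁ b₂ y-once)))))
    merge-count b₁ b₂ c₁ c₂ t (suc s) y-once (s≤s _) shared-yz with both-absent b₁ b₂ y-once
    ... | refl , refl = trans shared-yz (cong toℕ (sym (trans (Boolₚ.∨-identityʳ _) (Boolₚ.∨-identityʳ t))))

  module _ {P : List (List V)} {R : V → V → Bool} (P-R : P Represents R)
           (R-refl : ∀ y → R y y ≡ true) (u w : V) where

    private
      once : ∀ y → shared y y P ≡ 1
      once y = trans (shared≡ P-R y y) (cong toℕ (R-refl y))

      R-sym : ∀ y z → R y z ≡ R z y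
      R-sym y z = toℕ-injective (trans (sym (shared≡ P-R y z)) (trans (shared-sym y z P) (shared≡ P-R z y)))

      B₁ = proj₁ (extract _≟_ u P)
      Rest₁ = proj₂ (extract _≟_ u P)
      open Extraction (extract-correct u P (≤-reflexive (sym (once u))))
        renaming (length-split to length-split₁; shared-split to shared-split₁)

      members₁ : ∀ y → y ∈ᵇ B₁ ≡ R y u
      members₁ y = toℕ-injective (trans (extract-members u P (once u) y) (shared≡ P-R y u))

    addEdge-within : R u w ≡ true → addEdge _≟_ (u , w) P ≡ P
    addEdge-within Ruw rewrite members₁ w | R-sym w u | Ruw = refl

    module _ (Ruw : R u w ≡ false) where
      private
        w∉B₁ : w ∈ᵇ B₁ ≡ false
        w∉B₁ = trans (members₁ w) (trans (R-sym w u) Ruw)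

        shared-Rest₁ : ∀ y → shared y w Rest₁ ≡ shared y w P
        shared-Rest₁ y = sym (trans (shared-split₁ y w)
                                    (cong (λ o → toℕ o + shared y w Rest₁)
                                          (trans (cong (y ∈ᵇ B₁ ∧_) w∉B₁) (Boolₚ.∧-zeroʳ (y ∈ᵇ B₁)))))

        w-once : shared w w Rest₁ ≡ 1
        w-once = trans (shared-Rest₁ w) (once w)

        B₂ = proj₁ (extract _≟_ w Rest₁)
        Rest₂ = proj₂ (extract _≟_ w Rest₁)
        open Extraction (extract-correct w Rest₁ (≤-reflexive (sym w-once)))
          renaming (length-split to length-split₂; shared-split to shared-split₂)

        members₂ : ∀ y → y ∈ᵇ B₂ ≡ R y w
        members₂ y = toℕ-injective (trans (extract-members w Rest₁ w-once y) (trans (shared-Rest₁ y) (shared≡ P-R y w)))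

        decompose : ∀ y z → shared y z P ≡ toℕ (R y u ∧ R z u) + (toℕ (R y w ∧ R z w) + shared y z Rest₂)
        decompose y z rewrite shared-split₁ y z | shared-split₂ y z
                            | members₁ y | members₁ z | members₂ y | members₂ z = refl

        y-once : ∀ y → toℕ (R y u) + (toℕ (R y w) + shared y y Rest₂) ≡ 1
        y-once y = begin
          toℕ (R y u) + (toℕ (R y w) + shared y y Rest₂)
            ≡⟨ sym (cong₂ (λ p q → toℕ p + (toℕ q + shared y y Rest₂)) (Boolₚ.∧-idem (R y u)) (Boolₚ.∧-idem (R y w))) ⟩
          toℕ (R y u ∧ R y u) + (toℕ (R y w ∧ R y w) + shared y y Rest₂)
            ≡⟨ sym (decompose y y) ⟩
          shared y y P
            ≡⟨ once y ⟩
          1 ∎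
          where open ≡-Reasoning

        merged : List (List V)
        merged = (B₁ ++ B₂) ∷ Rest₂

        addEdge-merged : addEdge _≟_ (u , w) P ≡ merged
        addEdge-merged rewrite w∉B₁ = refl

        merged-represents : merged Represents link R u w
        merged-represents = represents λ y z → begin
          toℕ (y ∈ᵇ (B₁ ++ B₂) ∧ z ∈ᵇ (B₁ ++ B₂)) + shared y z Rest₂
            ≡⟨ cong (λ o → toℕ o + shared y z Rest₂) (cong₂ _∧_ (in-merged y) (in-merged z)) ⟩
          toℕ ((R y u ∨ R y w) ∧ (R z u ∨ R z w)) + shared y z Rest₂
            ≡⟨ merge-count (R y u) (R y w) (R z u) (R z w) (R y z) (shared y z Rest₂) (y-once y)
                 (≤-trans (≤-reflexive (shared-sym y z Rest₂)) (shared≤shared-self z y Rest₂))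
                 (trans (sym (decompose y z)) (shared≡ P-R y z)) ⟩
          toℕ (link R u w y z) ∎
          where
          open ≡-Reasoning
          in-merged : ∀ x → x ∈ᵇ (B₁ ++ B₂) ≡ R x u ∨ R x w
          in-merged x = trans (∈ᵇ-++ x B₁ B₂) (cong₂ _∨_ (members₁ x) (members₂ x))

      addEdge-across : addEdge _≟_ (u , w) P Represents link R u w
                     × suc (length (addEdge _≟_ (u , w) P)) ≡ length P
      addEdge-across rewrite addEdge-merged =
        merged-represents , sym (trans length-split₁ (cong suc length-split₂))

-- Γ_n as a path

odd : ℕ → Bool
odd zero = false
odd (suc n) = not (odd n)

odd-double : ∀ i → odd (i + i) ≡ false
odd-double zero = refl
odd-double (suc i) rewrite +-suc i i | odd-double i = refl

-- xw sits at 2 pos w or 2 pos w + 1, the order of the pair {0w, 1w} alternating with the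
-- parity of pos w; this is what makes the lifted edges xu — xv line up along a path.
pos : ∀ {n} → Word n → ℕ
pos [] = 0
pos (x ∷ w) = pos w + pos w + toℕ (if x then odd (pos w) else not (odd (pos w)))

pos< : ∀ {n} (w : Word n) → pos w < 2 ^ n
pos< [] = s≤s z≤n
pos< {suc n} (x ∷ w) = begin-strict
  pos w + pos w + toℕ _   ≤⟨ +-monoʳ-≤ (pos w + pos w) (toℕ≤1 _) ⟩
  pos w + pos w + 1       ≡⟨ trans (+-assoc (pos w) (pos w) 1) (cong (pos w +_) (+-comm (pos w) 1)) ⟩
  pos w + suc (pos w)     <⟨ +-mono-<-≤ (pos< w) (pos< w) ⟩
  2 ^ n + 2 ^ n           ≡⟨ cong (2 ^ n +_) (sym (+-identityʳ _)) ⟩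
  2 ^ suc n               ∎
  where open ≤-Reasoning

private
  halve : ∀ p q {r s} → r ≤ 1 → s ≤ 1 → p + p + r ≡ q + q + s → p ≡ q × r ≡ s
  halve zero zero _ _ e = refl , e
  halve zero (suc q) (s≤s z≤n) _ e rewrite +-suc q q = ⊥-elim (0≢1+n (suc-injective e))
  halve zero (suc q) z≤n _ ()
  halve (suc p) zero _ (s≤s z≤n) e rewrite +-suc p p = ⊥-elim (1+n≢0 (suc-injective e))
  halve (suc p) zero _ z≤n ()
  halve (suc p) (suc q) r≤1 s≤1 e rewrite +-suc p p | +-suc q q
    with halve p q r≤1 s≤1 (suc-injective (suc-injective e))
  ... | refl , r≡s = refl , r≡s

  parity-bit-injective : ∀ x y p →
    toℕ (if x then odd p else not (odd p)) ≡ toℕ (if y then odd p else not (odd p)) → x ≡ y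
  parity-bit-injective true true p _ = refl
  parity-bit-injective false false p _ = refl
  parity-bit-injective true false p e with odd p
  ... | true = ⊥-elim (1+n≢0 e)
  ... | false = ⊥-elim (0≢1+n e)
  parity-bit-injective false true p e with odd p
  ... | true = ⊥-elim (0≢1+n e)
  ... | false = ⊥-elim (1+n≢0 e)

pos-injective : ∀ {n} (u v : Word n) → pos u ≡ pos v → u ≡ v
pos-injective [] [] _ = refl
pos-injective (x ∷ u) (y ∷ v) e with halve (pos u) (pos v) (toℕ≤1 _) (toℕ≤1 _) e
... | pu≡pv , bits with pos-injective u v pu≡pv
... | refl = cong (_∷ u) (parity-bit-injective x y (pos u) bits)

length-allWords : ∀ n → length (allWords n) ≡ 2 ^ n
length-allWords zero = refl
length-allWords (suc n) = begin
  length (map (false ∷_) (allWords n) ++ map (true ∷_) (allWords n))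
    ≡⟨ Listₚ.length-++ (map (false ∷_) (allWords n)) ⟩
  length (map (false ∷_) (allWords n)) + length (map (true ∷_) (allWords n))
    ≡⟨ cong₂ _+_ (Listₚ.length-map (false ∷_) (allWords n)) (Listₚ.length-map (true ∷_) (allWords n)) ⟩
  length (allWords n) + length (allWords n)
    ≡⟨ cong (λ k → k + k) (length-allWords n) ⟩
  2 ^ n + 2 ^ n
    ≡⟨ cong (2 ^ n +_) (sym (+-identityʳ (2 ^ n))) ⟩
  2 ^ suc n ∎
  where open ≡-Reasoning

data Joins {n} (u v : Word n) (j : ℕ) : Set where
  up   : pos u ≡ j → pos v ≡ suc j → Joins u v j
  down : pos v ≡ j → pos u ≡ suc j → Joins u v j

Joins-swap : ∀ {n} {u v : Word n} {j} → Joins u v j → Joins v u j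
Joins-swap (up pu pv) = down pu pv
Joins-swap (down pv pu) = up pv pu

-- e is the parity of the position: false for the a-edges, true for the b, c and d-edges
data PathEdge {n} (u v : Word n) (e : Bool) : Set where
  loop : u ≡ v → PathEdge u v e
  step : ∀ {j} → Joins u v j → odd j ≡ e → PathEdge u v e

lift-positions : ∀ {n} (u v : Word n) i → pos u ≡ i → pos v ≡ suc i →
  pos (odd i ∷ u) ≡ suc (i + i) × pos (odd i ∷ v) ≡ suc (suc (i + i))
lift-positions u v i refl pv rewrite pv | +-suc (pos u) (pos u) with odd (pos u)
... | true = +-comm _ 1 , cong suc (+-identityʳ _)
... | false = +-comm _ 1 , cong suc (+-identityʳ _)

lift-joins : ∀ {n} {u v : Word n} {j} → Joins u v j → Joins (odd j ∷ u) (odd j ∷ v) (suc (j + j))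
lift-joins {u = u} {v} {j} (up pu pv) = uncurry up (lift-positions u v j pu pv)
lift-joins {u = u} {v} {j} (down pv pu) = uncurry down (lift-positions v u j pv pu)

lift : ∀ {n} (u v : Word n) x → PathEdge u v x → PathEdge (x ∷ u) (x ∷ v) true
lift u v x (loop refl) = loop refl
lift u v .(odd j) (step {j} joins refl) = step (lift-joins joins) (cong not (odd-double j))

a-joins : ∀ {n} (w : Word n) → Joins (false ∷ w) (true ∷ w) (pos w + pos w)
a-joins w with odd (pos w) in e
... | true = up (trans (cong (λ o → pos w + pos w + toℕ (not o)) e) (+-identityʳ _))
                (trans (cong (λ o → pos w + pos w + toℕ o) e) (+-comm _ 1))
... | false = down (trans (cong (λ o → pos w + pos w + toℕ o) e) (+-identityʳ _))
                   (trans (cong (λ o → pos w + pos w + toℕ (not o)) e) (+-comm _ 1))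

a-edge : ∀ {n} (w : Word n) → PathEdge w (act a w) false
a-edge [] = loop refl
a-edge (false ∷ w) = step (a-joins w) (odd-double (pos w))
a-edge (true ∷ w) = step (Joins-swap (a-joins w)) (odd-double (pos w))

b-edge : ∀ {n} (w : Word n) → PathEdge w (act b w) true
c-edge : ∀ {n} (w : Word n) → PathEdge w (act c w) true
d-edge : ∀ {n} (w : Word n) → PathEdge w (act d w) true
b-edge [] = loop refl
b-edge (false ∷ w) = lift w (act a w) false (a-edge w)
b-edge (true ∷ w) = lift w (act c w) true (c-edge w)
c-edge [] = loop refl
c-edge (false ∷ w) = lift w (act a w) false (a-edge w)
c-edge (true ∷ w) = lift w (act d w) true (d-edge w)
d-edge [] = loop refl
d-edge (false ∷ w) = loop refl
d-edge (true ∷ w) = lift w (act b w) true (b-edge w)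

edge-shape : ∀ {n} (s : Gen) (w : Word n) → Σ Bool (PathEdge w (act s w))
edge-shape a w = false , a-edge w
edge-shape b w = true , b-edge w
edge-shape c w = true , c-edge w
edge-shape d w = true , d-edge w

label : ∀ {n} → Word n × Word n → Label
label (u , v) = if pos u ≡ᵇ pos v then nothing else just (pos u ⊓ pos v)

label-loop : ∀ {n} (u : Word n) → label (u , u) ≡ nothing
label-loop u rewrite ≡ᵇ-refl (pos u) = refl

label-joins : ∀ {n} (u v : Word n) {j} → Joins u v j → label (u , v) ≡ just j
label-joins u v {j} (up pu pv) rewrite pu | pv | ≢⇒≡ᵇ-false (<⇒≢ (n<1+n j)) | m≤n⇒m⊓n≡m (n≤1+n j) = refl
label-joins u v {j} (down pv pu) rewrite pu | pv | ≢⇒≡ᵇ-false (1+n≢n {j}) | m≥n⇒m⊓n≡n (n≤1+n j) = refl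

double+1 : Label → Label
double+1 nothing = nothing
double+1 (just i) = just (suc (i + i))

label-lift : ∀ {n} (u v : Word n) x → PathEdge u v x → label (x ∷ u , x ∷ v) ≡ double+1 (label (u , v))
label-lift u v x (loop refl) rewrite label-loop (x ∷ u) | label-loop u = refl
label-lift u v .(odd j) (step {j} joins refl) =
  trans (label-joins (odd j ∷ u) (odd j ∷ v) (lift-joins joins)) (sym (cong double+1 (label-joins u v joins)))

module WordUnionFind {n : ℕ} = UnionFind (_≟W_ {n})
open WordUnionFind

singletons : ∀ {n} → List (Word n) → List (List (Word n))
singletons = map (_∷ [])

shared-singletons-distinct : ∀ {n} {y z : Word n} → y ≢ z → ∀ L → shared y z (singletons L) ≡ 0
shared-singletons-distinct y≢z [] = refl
shared-singletons-distinct {y = y} {z} y≢z (v ∷ L) with y ≟W v | z ≟W v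
... | yes refl | yes refl = ⊥-elim (y≢z refl)
... | yes _ | no _ = shared-singletons-distinct y≢z L
... | no _ | _ = shared-singletons-distinct y≢z L

shared-singletons-prefix : ∀ {n} x (y z : Word n) L →
  shared (x ∷ y) (x ∷ z) (singletons (map (x ∷_) L)) ≡ shared y z (singletons L)
shared-singletons-prefix x y z [] = refl
shared-singletons-prefix false y z (v ∷ L) = cong (_ +_) (shared-singletons-prefix false y z L)
shared-singletons-prefix true y z (v ∷ L) = cong (_ +_) (shared-singletons-prefix true y z L)

shared-singletons-other-prefix : ∀ {n} x x′ (y z : Word n) L → x ≢ x′ →
  shared (x ∷ y) (x ∷ z) (singletons (map (x′ ∷_) L)) ≡ 0
shared-singletons-other-prefix x x′ y z [] _ = refl
shared-singletons-other-prefix false false y z (v ∷ L) x≢x′ = ⊥-elim (x≢x′ refl)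
shared-singletons-other-prefix true true y z (v ∷ L) x≢x′ = ⊥-elim (x≢x′ refl)
shared-singletons-other-prefix false true y z (v ∷ L) x≢x′ = shared-singletons-other-prefix false true y z L x≢x′
shared-singletons-other-prefix true false y z (v ∷ L) x≢x′ = shared-singletons-other-prefix true false y z L x≢x′

allWords-once : ∀ {n} (y : Word n) → shared y y (singletons (allWords n)) ≡ 1
allWords-once [] = refl
allWords-once {suc n} (x ∷ y) = begin
  shared (x ∷ y) (x ∷ y) (singletons (map (false ∷_) (allWords n) ++ map (true ∷_) (allWords n)))
    ≡⟨ cong (shared (x ∷ y) (x ∷ y)) (Listₚ.map-++ (_∷ []) (map (false ∷_) (allWords n)) (map (true ∷_) (allWords n))) ⟩
  shared (x ∷ y) (x ∷ y) (singletons (map (false ∷_) (allWords n)) ++ singletons (map (true ∷_) (allWords n)))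
    ≡⟨ shared-++ (x ∷ y) (x ∷ y) (singletons (map (false ∷_) (allWords n))) _ ⟩
  shared (x ∷ y) (x ∷ y) (singletons (map (false ∷_) (allWords n)))
    + shared (x ∷ y) (x ∷ y) (singletons (map (true ∷_) (allWords n)))
    ≡⟨ halves x ⟩
  1 ∎
  where
  open ≡-Reasoning
  halves : ∀ x → shared (x ∷ y) (x ∷ y) (singletons (map (false ∷_) (allWords n)))
               + shared (x ∷ y) (x ∷ y) (singletons (map (true ∷_) (allWords n))) ≡ 1
  halves false rewrite shared-singletons-prefix false y y (allWords n)
                     | shared-singletons-other-prefix false true y y (allWords n) (λ ()) | allWords-once y = refl
  halves true rewrite shared-singletons-prefix true y y (allWords n)
                    | shared-singletons-other-prefix true false y y (allWords n) (λ ()) | allWords-once y = refl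

connected-joins : ∀ {n} {C} {u v : Word n} {j} → Joins u v j →
  connected C (pos u) (pos v) ≡ C j
connected-joins {C = C} {j = j} (up pu pv) rewrite pu | pv with C j
... | true = ≡ᵇ-refl (leftmost C j)
... | false = ≢⇒≡ᵇ-false (<⇒≢ (s≤s (leftmost≤ C j)))
connected-joins {C = C} {j = j} (down pv pu) rewrite pu | pv with C j
... | true = ≡ᵇ-refl (leftmost C j)
... | false = ≢⇒≡ᵇ-false ((<⇒≢ (s≤s (leftmost≤ C j))) ∘ sym)

connected-insert-joins : ∀ {n} {C} {u v : Word n} {j} → Joins u v j → C j ≡ false → ∀ p q →
  connected (insert j C) p q ≡ link (connected C) (pos u) (pos v) p q
connected-insert-joins (up pu pv) Cj p q rewrite pu | pv = connected-insert Cj p q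
connected-insert-joins {C = C} {j = j} (down pv pu) Cj p q rewrite pu | pv =
  trans (connected-insert Cj p q) (link-swap (connected C) j (suc j) p q)

module SpanningSubgraphs (n : ℕ) where

  N m : ℕ
  N = 2 ^ n
  m = N ∸ 1

  IsPathEdge : Word n × Word n → Set
  IsPathEdge (u , v) = Σ Bool (PathEdge u v)

  coverage : List (Word n × Word n) → ℕ → Bool
  coverage A = covers (map label A)

  partition : List (Word n × Word n) → List (List (Word n))
  partition A = foldr (addEdge _≟W_) (singletons (allWords n)) A

  connectedBy : (ℕ → Bool) → Word n → Word n → Bool
  connectedBy C y z = connected C (pos y) (pos z)

  Invariant : List (List (Word n)) → (ℕ → Bool) → Set
  Invariant P C = P Represents connectedBy C × length P + count< m C ≡ N

  joins-below : ∀ {u v : Word n} {j} → Joins u v j → j < m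
  joins-below {v = v} (up _ pv) = ∸-monoˡ-≤ 1 (subst (_< N) pv (pos< v))
  joins-below {u = u} (down _ pu) = ∸-monoˡ-≤ 1 (subst (_< N) pu (pos< u))

  private
    Invariant-cong : ∀ {P C D} → (∀ k → C k ≡ D k) → Invariant P C → Invariant P D
    Invariant-cong {P} C≗D (P-C , size) =
      represents (λ y z → trans (shared≡ P-C y z) (cong toℕ (connected-cong C≗D (pos y) (pos z)))) ,
      trans (cong (length P +_) (sym (count<-cong m C≗D))) size

    initial : Invariant (singletons (allWords n)) (λ _ → false)
    initial = represents shared-singletons , trans (cong₂ _+_ length-singletons (count<-empty m)) (+-identityʳ N)
      where
      length-singletons : length (singletons (allWords n)) ≡ N
      length-singletons = trans (Listₚ.length-map (_∷ []) (allWords n)) (length-allWords n)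
      shared-singletons : ∀ y z → shared y z (singletons (allWords n)) ≡ toℕ (connectedBy (λ _ → false) y z)
      shared-singletons y z rewrite leftmost-empty (pos y) | leftmost-empty (pos z) with y ≟W z
      ... | yes refl rewrite ≡ᵇ-refl (pos y) = allWords-once y
      ... | no y≢z = trans (shared-singletons-distinct y≢z (allWords n))
                           (cong toℕ (sym (≢⇒≡ᵇ-false (y≢z ∘ pos-injective y z))))

  components-invariant : ∀ A → All IsPathEdge A → Invariant (partition A) (coverage A)
  components-invariant [] [] = initial
  components-invariant ((u , v) ∷ A) ((e , shape) ∷ shapes) = add shape
    where
    C = coverage A
    P = partition A
    IH : Invariant P C
    IH = components-invariant A shapes
    P-C = proj₁ IH

    connectedBy-refl : ∀ y → connectedBy C y y ≡ true
    connectedBy-refl y = ≡ᵇ-refl (leftmost C (pos y))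

    coverage-∷ : ∀ {l} → label (u , v) ≡ l → ∀ k → covers (l ∷ map label A) k ≡ coverage ((u , v) ∷ A) k
    coverage-∷ uv≡l k = cong (λ l → covers (l ∷ map label A) k) (sym uv≡l)

    add : PathEdge u v e → Invariant (addEdge _≟W_ (u , v) P) (coverage ((u , v) ∷ A))
    add (loop refl) rewrite addEdge-within P-C connectedBy-refl u u (connectedBy-refl u) =
      Invariant-cong (coverage-∷ (label-loop u)) IH
    add (step {j} joins _) with C j in Cj
    ... | true rewrite addEdge-within P-C connectedBy-refl u v (trans (connected-joins joins) Cj) =
      Invariant-cong (λ k → trans (already-covered k) (coverage-∷ (label-joins u v joins) k)) IH
      where
      already-covered : ∀ k → C k ≡ (k ≡ᵇ j) ∨ C k
      already-covered k with k ≡ᵇ j in k≡j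
      ... | true = trans (cong C (≡ᵇ-true⇒≡ k≡j)) Cj
      ... | false = refl
    ... | false =
      Invariant-cong (λ k → trans (Boolₚ.∨-comm (C k) (k ≡ᵇ j)) (coverage-∷ (label-joins u v joins) k))
                     (represents shared-P′ , size)
      where
      across = addEdge-across P-C connectedBy-refl u v (trans (connected-joins joins) Cj)
      P′ = addEdge _≟W_ (u , v) P

      shared-P′ : ∀ y z → shared y z P′ ≡ toℕ (connectedBy (insert j C) y z)
      shared-P′ y z = trans (shared≡ (proj₁ across) y z)
                            (cong toℕ (sym (connected-insert-joins joins Cj (pos y) (pos z))))

      size : length P′ + count< m (insert j C) ≡ N
      size = begin
        length P′ + count< m (insert j C)      ≡⟨ cong (length P′ +_) (count<-insert m C (joins-below joins)) ⟩
        length P′ + (count< m C + toℕ (not (C j))) ≡⟨ cong (λ o → length P′ + (count< m C + toℕ (not o))) Cj ⟩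
        length P′ + (count< m C + 1)           ≡⟨ cong (length P′ +_) (+-comm (count< m C) 1) ⟩
        length P′ + suc (count< m C)           ≡⟨ +-suc (length P′) (count< m C) ⟩
        suc (length P′) + count< m C           ≡⟨ cong (_+ count< m C) (proj₂ across) ⟩
        length P + count< m C                  ≡⟨ proj₂ IH ⟩
        N                                      ∎
        where open ≡-Reasoning

  rank-coverage : ∀ A → All IsPathEdge A → rank (schreier n) A ≡ count< m (coverage A)
  rank-coverage A shapes = begin
    length (allWords n) ∸ length (partition A)   ≡⟨ cong₂ _∸_ (length-allWords n) length-partition ⟩
    N ∸ (N ∸ count< m (coverage A))              ≡⟨ m∸[m∸n]≡n (≤-trans (count<≤ m (coverage A)) (m∸n≤m N 1)) ⟩
    count< m (coverage A)                        ∎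
    where
    open ≡-Reasoning
    length-partition : length (partition A) ≡ N ∸ count< m (coverage A)
    length-partition = trans (sym (m+n∸n≡m (length (partition A)) (count< m (coverage A))))
                             (cong (_∸ count< m (coverage A)) (proj₂ (components-invariant A shapes)))

private
  half-≡ᵇ : ∀ q p → toℕ (q ≡ᵇ p + p) + toℕ (q ≡ᵇ suc (p + p)) ≡ toℕ (⌊ q /2⌋ ≡ᵇ p)
  half-≡ᵇ zero zero = refl
  half-≡ᵇ zero (suc p) = refl
  half-≡ᵇ (suc zero) zero = refl
  half-≡ᵇ (suc zero) (suc p) rewrite +-suc p p = refl
  half-≡ᵇ (suc (suc q)) zero = refl
  half-≡ᵇ (suc (suc q)) (suc p) rewrite +-suc p p = half-≡ᵇ q p

  half-<ᵇ : ∀ q M → (⌊ q /2⌋ <ᵇ M) ≡ (q <ᵇ M + M)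
  half-<ᵇ zero zero = refl
  half-<ᵇ zero (suc M) = refl
  half-<ᵇ (suc zero) zero = refl
  half-<ᵇ (suc zero) (suc M) rewrite +-suc M M = refl
  half-<ᵇ (suc (suc q)) zero = refl
  half-<ᵇ (suc (suc q)) (suc M) rewrite +-suc M M = half-<ᵇ q M

  children-at : ∀ q p → toℕ (q ≡ᵇ p + p + toℕ (not (odd p))) + toℕ (q ≡ᵇ p + p + toℕ (odd p))
                      ≡ toℕ (⌊ q /2⌋ ≡ᵇ p)
  children-at q p with odd p
  ... | true rewrite +-identityʳ (p + p) | +-comm (p + p) 1 = half-≡ᵇ q p
  ... | false rewrite +-identityʳ (p + p) | +-comm (p + p) 1 =
    trans (+-comm (toℕ (q ≡ᵇ suc (p + p))) _) (half-≡ᵇ q p)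

-- Loops and multiplicities of the edges of Γ_n

count-positions : ∀ k q → count (λ u → q ≡ᵇ pos u) (allWords k) ≡ toℕ (q <ᵇ 2 ^ k)
count-positions zero zero = refl
count-positions zero (suc q) = refl
count-positions (suc k) q = begin
  count (λ u → q ≡ᵇ pos u) (map (false ∷_) (allWords k) ++ map (true ∷_) (allWords k))
    ≡⟨ count-++ (λ u → q ≡ᵇ pos u) (map (false ∷_) (allWords k)) _ ⟩
  count (λ u → q ≡ᵇ pos u) (map (false ∷_) (allWords k)) + count (λ u → q ≡ᵇ pos u) (map (true ∷_) (allWords k))
    ≡⟨ cong₂ _+_ (count-map (λ u → q ≡ᵇ pos u) (false ∷_) (allWords k))
                 (count-map (λ u → q ≡ᵇ pos u) (true ∷_) (allWords k)) ⟩
  count (λ u → q ≡ᵇ pos (false ∷ u)) (allWords k) + count (λ u → q ≡ᵇ pos (true ∷ u)) (allWords k)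
    ≡⟨ count-merge (λ u → children-at q (pos u)) (allWords k) ⟩
  count (λ u → ⌊ q /2⌋ ≡ᵇ pos u) (allWords k)
    ≡⟨ count-positions k ⌊ q /2⌋ ⟩
  toℕ (⌊ q /2⌋ <ᵇ 2 ^ k)
    ≡⟨ cong toℕ (trans (half-<ᵇ q (2 ^ k)) (cong (λ M → q <ᵇ 2 ^ k + M) (sym (+-identityʳ (2 ^ k))))) ⟩
  toℕ (q <ᵇ 2 ^ suc k) ∎
  where open ≡-Reasoning

representatives : (n : ℕ) → Gen → List (Word n)
representatives n s = filter (λ u → Bool.T? (leqW u (act s u))) (allWords n)

edgesOf : (n : ℕ) → Gen → List (Word n × Word n)
edgesOf n s = map (λ u → u , act s u) (representatives n s)

labels : (n : ℕ) → Gen → List Label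
labels n s = map label (edgesOf n s)

private
  filter-map : {A B : Set} (p : B → Bool) (f : A → B) (xs : List A) →
    filter (Bool.T? ∘ p) (map f xs) ≡ map f (filter (Bool.T? ∘ p ∘ f) xs)
  filter-map p f [] = refl
  filter-map p f (x ∷ xs) with p (f x)
  ... | true = cong (f x ∷_) (filter-map p f xs)
  ... | false = filter-map p f xs

  leqW-refl : ∀ {n} (u : Word n) → leqW u u ≡ true
  leqW-refl [] = refl
  leqW-refl (false ∷ u) = leqW-refl u
  leqW-refl (true ∷ u) = leqW-refl u

  labelsWithFirst : ∀ n → Gen → Bool → List Label
  labelsWithFirst n s x =
    map (λ u → label (x ∷ u , act s (x ∷ u))) (filter (λ u → Bool.T? (leqW (x ∷ u) (act s (x ∷ u)))) (allWords n))

  labels-split : ∀ n s → labels (suc n) s ≡ labelsWithFirst n s false ++ labelsWithFirst n s true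
  labels-split n s = begin
    map label (map pair (filter P? (map (false ∷_) W ++ map (true ∷_) W)))
      ≡⟨ cong (map label ∘ map pair) (Listₚ.filter-++ P? (map (false ∷_) W) (map (true ∷_) W)) ⟩
    map label (map pair (filter P? (map (false ∷_) W) ++ filter P? (map (true ∷_) W)))
      ≡⟨ cong (map label ∘ map pair) (cong₂ _++_ (filter-map p (false ∷_) W) (filter-map p (true ∷_) W)) ⟩
    map label (map pair (map (false ∷_) (first false) ++ map (true ∷_) (first true)))
      ≡⟨ trans (cong (map label) (Listₚ.map-++ pair (map (false ∷_) (first false)) (map (true ∷_) (first true))))
               (Listₚ.map-++ label (map pair (map (false ∷_) (first false))) (map pair (map (true ∷_) (first true)))) ⟩
    map label (map pair (map (false ∷_) (first false))) ++ map label (map pair (map (true ∷_) (first true)))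
      ≡⟨ sym (cong₂ _++_ (merge-maps false) (merge-maps true)) ⟩
    labelsWithFirst n s false ++ labelsWithFirst n s true ∎
    where
    open ≡-Reasoning
    W = allWords n
    p : Word (suc n) → Bool
    p u = leqW u (act s u)
    P? = Bool.T? ∘ p
    pair : Word (suc n) → Word (suc n) × Word (suc n)
    pair u = u , act s u
    first : Bool → List (Word n)
    first x = filter (λ u → Bool.T? (leqW (x ∷ u) (act s (x ∷ u)))) W
    merge-maps : ∀ x → labelsWithFirst n s x ≡ map label (map pair (map (x ∷_) (first x)))
    merge-maps x = trans (Listₚ.map-∘ (first x)) (cong (map label) (Listₚ.map-∘ (first x)))

  filter-all-true : {A : Set} (p : A → Bool) → (∀ x → p x ≡ true) → ∀ xs → filter (Bool.T? ∘ p) xs ≡ xs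
  filter-all-true p all-true [] = refl
  filter-all-true p all-true (x ∷ xs) rewrite all-true x = cong (x ∷_) (filter-all-true p all-true xs)

  filter-none-true : {A : Set} (xs : List A) → filter (λ _ → Bool.T? false) xs ≡ []
  filter-none-true [] = refl
  filter-none-true (x ∷ xs) = filter-none-true xs

  lift-labels : ∀ {n} x (g : Word n → Word n) L → (∀ u → PathEdge u (g u) x) →
    map (λ u → label (x ∷ u , x ∷ g u)) L ≡ map double+1 (map label (map (λ u → u , g u) L))
  lift-labels x g [] _ = refl
  lift-labels x g (u ∷ L) edge = cong₂ _∷_ (label-lift u (g u) x (edge u)) (lift-labels x g L edge)

labels-a : ∀ n → labels (suc n) a ≡ map (λ u → just (pos u + pos u)) (allWords n)
labels-a n = begin
  labels (suc n) a
    ≡⟨ labels-split n a ⟩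
  map (λ u → label (false ∷ u , true ∷ u)) (filter (λ _ → Bool.T? true) (allWords n))
    ++ map (λ u → label (true ∷ u , false ∷ u)) (filter (λ _ → Bool.T? false) (allWords n))
    ≡⟨ cong₂ _++_ (cong (map _) (filter-all-true (λ _ → true) (λ _ → refl) (allWords n)))
                  (cong (map _) (filter-none-true (allWords n))) ⟩
  map (λ u → label (false ∷ u , true ∷ u)) (allWords n) ++ []
    ≡⟨ Listₚ.++-identityʳ _ ⟩
  map (λ u → label (false ∷ u , true ∷ u)) (allWords n)
    ≡⟨ Listₚ.map-cong (λ u → label-joins (false ∷ u) (true ∷ u) (a-joins u)) (allWords n) ⟩
  map (λ u → just (pos u + pos u)) (allWords n) ∎
  where open ≡-Reasoning

labels-b : ∀ n → labels (suc n) b ≡ map double+1 (labels n a) ++ map double+1 (labels n c)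
labels-b n = trans (labels-split n b) (cong₂ _++_ (lift-labels false (act a) (representatives n a) a-edge)
                                                 (lift-labels true (act c) (representatives n c) c-edge))

labels-c : ∀ n → labels (suc n) c ≡ map double+1 (labels n a) ++ map double+1 (labels n d)
labels-c n = trans (labels-split n c) (cong₂ _++_ (lift-labels false (act a) (representatives n a) a-edge)
                                                 (lift-labels true (act d) (representatives n d) d-edge))

labels-d : ∀ n → labels (suc n) d ≡ map (λ _ → nothing) (allWords n) ++ map double+1 (labels n b)
labels-d n = trans (labels-split n d) (cong₂ _++_ loops-at-0 (lift-labels true (act b) (representatives n b) b-edge))
  where
  loops-at-0 : map (λ u → label (false ∷ u , false ∷ u)) (filter (λ u → Bool.T? (leqW u u)) (allWords n))
             ≡ map (λ _ → nothing) (allWords n)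
  loops-at-0 = trans (cong (map _) (filter-all-true (λ u → leqW u u) leqW-refl (allWords n)))
                     (Listₚ.map-cong (λ u → label-loop (false ∷ u)) (allWords n))

data EvenOrOdd : ℕ → Set where
  twice : ∀ q → EvenOrOdd (q + q)
  twice+1 : ∀ q → EvenOrOdd (suc (q + q))

even-or-odd : ∀ j → EvenOrOdd j
even-or-odd zero = twice zero
even-or-odd (suc j) with even-or-odd j
... | twice q = twice+1 q
... | twice+1 q = subst EvenOrOdd (cong suc (+-suc q q)) (twice (suc q))

private
  ≡ᵇ-double : ∀ q i → (q + q ≡ᵇ i + i) ≡ (q ≡ᵇ i)
  ≡ᵇ-double zero zero = refl
  ≡ᵇ-double zero (suc i) = refl
  ≡ᵇ-double (suc q) zero = refl
  ≡ᵇ-double (suc q) (suc i) rewrite +-suc q q | +-suc i i = ≡ᵇ-double q i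

  ≡ᵇ-even-odd : ∀ q i → (q + q ≡ᵇ suc (i + i)) ≡ false
  ≡ᵇ-even-odd zero i = refl
  ≡ᵇ-even-odd (suc q) zero rewrite +-suc q q = refl
  ≡ᵇ-even-odd (suc q) (suc i) rewrite +-suc q q | +-suc i i = ≡ᵇ-even-odd q i

  <ᵇ-double : ∀ p M → (p + p <ᵇ M + M) ≡ (p <ᵇ M)
  <ᵇ-double zero zero = refl
  <ᵇ-double zero (suc M) = refl
  <ᵇ-double (suc p) zero = refl
  <ᵇ-double (suc p) (suc M) rewrite +-suc p p | +-suc M M = <ᵇ-double p M

  <ᵇ-double+1 : ∀ p M → (suc (p + p) <ᵇ M + M) ≡ (p <ᵇ M)
  <ᵇ-double+1 zero zero = refl
  <ᵇ-double+1 zero (suc M) rewrite +-suc M M = refl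
  <ᵇ-double+1 (suc p) zero = refl
  <ᵇ-double+1 (suc p) (suc M) rewrite +-suc p p | +-suc M M = <ᵇ-double+1 p M

  toℕ-<ᵇ : ∀ {p M} → p < M → toℕ (p <ᵇ M) ≡ 1
  toℕ-<ᵇ {zero} {suc M} _ = refl
  toℕ-<ᵇ {suc p} {suc M} (s≤s p<M) = toℕ-<ᵇ p<M

  2^suc : ∀ k → 2 ^ suc k ≡ 2 ^ k + 2 ^ k
  2^suc k = cong (2 ^ k +_) (+-identityʳ (2 ^ k))

bcdCount : (Label → Bool) → ℕ → ℕ
bcdCount p n = count p (labels n b) + (count p (labels n c) + count p (labels n d))

-- The self-similarity of Γ_(n+1): its b, c, d-edges are the a, c; a, d; b-edges of Γ_n moved
-- to odd positions by double+1, plus a d-loop at every word 0w.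
bcdCount-suc : ∀ p n → bcdCount p (suc n) ≡
  2 * count (p ∘ double+1) (labels n a) + bcdCount (p ∘ double+1) n + count (λ _ → p nothing) (allWords n)
bcdCount-suc p n rewrite labels-b n | labels-c n | labels-d n
  | count-++ p (map double+1 (labels n a)) (map double+1 (labels n c))
  | count-++ p (map double+1 (labels n a)) (map double+1 (labels n d))
  | count-++ p (map (λ _ → nothing) (allWords n)) (map double+1 (labels n b))
  | count-map p (λ _ → nothing) (allWords n)
  | count-map p double+1 (labels n a) | count-map p double+1 (labels n b)
  | count-map p double+1 (labels n c) | count-map p double+1 (labels n d) =
  rearrange (count (p ∘ double+1) (labels n a)) (count (p ∘ double+1) (labels n b))
            (count (p ∘ double+1) (labels n c)) (count (p ∘ double+1) (labels n d))
            (count (λ _ → p nothing) (allWords n))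
  where
  rearrange : ∀ A B C D Z → A + C + (A + D + (Z + B)) ≡ 2 * A + (B + (C + D)) + Z
  rearrange = solve-ℕ

bcdCount-cong : ∀ {p q} → (∀ l → p l ≡ q l) → ∀ n → bcdCount p n ≡ bcdCount q n
bcdCount-cong p≗q n =
  cong₂ _+_ (count-cong p≗q (labels n b)) (cong₂ _+_ (count-cong p≗q (labels n c)) (count-cong p≗q (labels n d)))

private
  isEdge-even-double+1 : ∀ q l → isEdge (q + q) (double+1 l) ≡ false
  isEdge-even-double+1 q nothing = refl
  isEdge-even-double+1 q (just i) = ≡ᵇ-even-odd q i

  isEdge-odd-double+1 : ∀ q l → isEdge (suc (q + q)) (double+1 l) ≡ isEdge q l
  isEdge-odd-double+1 q nothing = refl
  isEdge-odd-double+1 q (just i) = ≡ᵇ-double q i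

  isLoop-double+1 : ∀ l → isLoop (double+1 l) ≡ isLoop l
  isLoop-double+1 nothing = refl
  isLoop-double+1 (just i) = refl

a-count : ∀ k p → count p (labels (suc k) a) ≡ count (λ u → p (just (pos u + pos u))) (allWords k)
a-count k p = trans (cong (count p) (labels-a k)) (count-map p (λ u → just (pos u + pos u)) (allWords k))

a-multiplicity-even : ∀ k q → multiplicity (q + q) (labels (suc k) a) ≡ toℕ (q <ᵇ 2 ^ k)
a-multiplicity-even k q =
  trans (a-count k (isEdge (q + q))) (trans (count-cong (λ u → ≡ᵇ-double q (pos u)) (allWords k)) (count-positions k q))

a-multiplicity-odd : ∀ k q → multiplicity (suc (q + q)) (labels (suc k) a) ≡ 0
a-multiplicity-odd k q =
  trans (a-count k (isEdge (suc (q + q))))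
        (trans (count-cong (λ u → trans (≡ᵇ-sym (suc (q + q)) (pos u + pos u)) (≡ᵇ-even-odd (pos u) q)) (allWords k))
               (count-none (allWords k)))

a-loops : ∀ k → loops (labels (suc k) a) ≡ 0
a-loops k = trans (a-count k isLoop) (count-none (allWords k))

bcd-multiplicity-even : ∀ n q → bcdCount (isEdge (q + q)) (suc n) ≡ 0
bcd-multiplicity-even n q rewrite bcdCount-suc (isEdge (q + q)) n
  | count-cong (isEdge-even-double+1 q) (labels n a) | count-none (labels n a)
  | bcdCount-cong (isEdge-even-double+1 q) n
  | count-none (labels n b) | count-none (labels n c) | count-none (labels n d)
  | count-none (allWords n) = refl

bcd-multiplicity-odd : ∀ k q → bcdCount (isEdge (suc (q + q))) (suc k) ≡ 2 * toℕ (suc q <ᵇ 2 ^ k)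
bcd-multiplicity-odd zero q = refl
bcd-multiplicity-odd (suc k) q rewrite bcdCount-suc (isEdge (suc (q + q))) (suc k)
  | count-cong (isEdge-odd-double+1 q) (labels (suc k) a)
  | bcdCount-cong (isEdge-odd-double+1 q) (suc k)
  | count-none (allWords (suc k))
  | +-identityʳ (2 * multiplicity q (labels (suc k) a) + bcdCount (isEdge q) (suc k))
  | 2^suc k = by-parity (even-or-odd q)
  where
  by-parity : EvenOrOdd q → 2 * multiplicity q (labels (suc k) a) + bcdCount (isEdge q) (suc k)
                          ≡ 2 * toℕ (suc q <ᵇ 2 ^ k + 2 ^ k)
  by-parity (twice r) rewrite a-multiplicity-even k r | bcd-multiplicity-even k r | <ᵇ-double+1 r (2 ^ k) =
    +-identityʳ _
  by-parity (twice+1 r) rewrite a-multiplicity-odd k r | bcd-multiplicity-odd k r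
    | sym (+-suc r r) | <ᵇ-double (suc r) (2 ^ k) = refl

bcd-loops : ∀ k → bcdCount isLoop (suc k) ≡ 2 ^ suc k + 4
bcd-loops zero = refl
bcd-loops (suc k) rewrite bcdCount-suc isLoop (suc k)
  | count-cong isLoop-double+1 (labels (suc k) a) | a-loops k
  | bcdCount-cong isLoop-double+1 (suc k) | bcd-loops k
  | count-all (allWords (suc k)) | length-allWords (suc k) = rearrange (2 ^ suc k)
  where
  rearrange : ∀ P → P + 4 + P ≡ P + (P + 0) + 4
  rearrange = solve-ℕ

edgeLabels : ℕ → List Label
edgeLabels n = map label (edges (schreier n))

edgeLabels-count : ∀ n p → count p (edgeLabels n) ≡ count p (labels n a) + bcdCount p n
edgeLabels-count n p
  rewrite Listₚ.map-++ label (edgesOf n a) (edgesOf n b ++ (edgesOf n c ++ (edgesOf n d ++ [])))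
        | Listₚ.map-++ label (edgesOf n b) (edgesOf n c ++ (edgesOf n d ++ []))
        | Listₚ.map-++ label (edgesOf n c) (edgesOf n d ++ [])
        | Listₚ.map-++ label (edgesOf n d) []
        | count-++ p (labels n a) (labels n b ++ (labels n c ++ (labels n d ++ [])))
        | count-++ p (labels n b) (labels n c ++ (labels n d ++ []))
        | count-++ p (labels n c) (labels n d ++ [])
        | count-++ p (labels n d) [] | +-identityʳ (count p (labels n d)) = refl

edge-loops : ∀ k → loops (edgeLabels (suc k)) ≡ 2 ^ suc k + 4
edge-loops k rewrite edgeLabels-count (suc k) isLoop | a-loops k = bcd-loops k

private
  halve-< : ∀ q M → q + q < M + M → q < M
  halve-< q M h with q <? M
  ... | yes q<M = q<M
  ... | no q≮M = contradiction h (≤⇒≯ (+-mono-≤ (≮⇒≥ q≮M) (≮⇒≥ q≮M)))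

  <∸1⇒suc< : ∀ {i n} → i < n ∸ 1 → suc i < n
  <∸1⇒suc< {n = suc n} i<n = s≤s i<n

edge-multiplicity : ∀ k j → j < 2 ^ suc k ∸ 1 → multiplicity j (edgeLabels (suc k)) ≡ suc (toℕ (odd j))
edge-multiplicity k j j<m rewrite edgeLabels-count (suc k) (isEdge j) = by-parity (even-or-odd j) j<m
  where
  by-parity : ∀ {j} → EvenOrOdd j → j < 2 ^ suc k ∸ 1 →
    multiplicity j (labels (suc k) a) + bcdCount (isEdge j) (suc k) ≡ suc (toℕ (odd j))
  by-parity (twice q) j<m
    rewrite a-multiplicity-even k q | bcd-multiplicity-even k q | odd-double q =
    trans (+-identityʳ _)
          (toℕ-<ᵇ (halve-< q (2 ^ k) (subst (q + q <_) (2^suc k) (<-trans (n<1+n (q + q)) (<∸1⇒suc< j<m)))))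
  by-parity (twice+1 q) j<m
    rewrite a-multiplicity-odd k q | bcd-multiplicity-odd k q | odd-double q =
    cong (2 *_) (toℕ-<ᵇ (halve-< (suc q) (2 ^ k) (subst₂ _<_ (sym (+-suc (suc q) q)) (2^suc k) (<∸1⇒suc< j<m))))

-- The Tutte polynomial of Γ_n

product<-alternating : ∀ t (A B : ℤ) → product< (suc (t + t)) (λ j → if odd j then B else A) ≡ A ℤ.^ suc t ℤ.* B ℤ.^ t
product<-alternating zero A B = one-factor A B
  where
  one-factor : ∀ A B → 1ℤ ℤ.* A ≡ A ℤ.* 1ℤ ℤ.* 1ℤ
  one-factor = solve-ℤ
product<-alternating (suc t) A B rewrite +-suc t t | product<-alternating t A B | odd-double t =
  two-more A B (A ℤ.^ t) (B ℤ.^ t)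
  where
  two-more : ∀ A B P Q → A ℤ.* P ℤ.* Q ℤ.* B ℤ.* A ≡ A ℤ.* (A ℤ.* P) ℤ.* (B ℤ.* Q)
  two-more = solve-ℤ

module Γ (k : ℕ) (x y : ℤ) where
  n = suc k
  X Y : ℤ
  X = x ℤ.- 1ℤ
  Y = y ℤ.- 1ℤ
  open SpanningSubgraphs n public
  open PathExpansion m X Y public

  E : List (Word n × Word n)
  E = edges (schreier n)

  E-path-edges : All IsPathEdge E
  E-path-edges = Allₚ.++⁺ (of a) (Allₚ.++⁺ (of b) (Allₚ.++⁺ (of c) (Allₚ.++⁺ (of d) [])))
    where
    of : ∀ s → All IsPathEdge (edgesOf n s)
    of s = Allₚ.map⁺ (All.universal (edge-shape s) (representatives n s))

  labels-below : ∀ {A} → All IsPathEdge A → All (Maybe.All (_< m)) (map label A)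
  labels-below shapes = Allₚ.map⁺ (All.map below shapes)
    where
    below : ∀ {e} → IsPathEdge e → Maybe.All (_< m) (label e)
    below {u , _} (_ , loop refl) rewrite label-loop u = Maybe.nothing
    below {u , v} (_ , step joins _) rewrite label-joins u v joins = Maybe.just (joins-below joins)

  rank-E : rank (schreier n) E ≡ m
  rank-E = trans (rank-coverage E E-path-edges)
                 (count<-full m (coverage E) (λ {j} j<m → covers-multiplicity j (edgeLabels n)
                   (subst (1 ≤_) (sym (edge-multiplicity k j j<m)) (s≤s z≤n))))

  ∅ : ℕ → Bool
  ∅ _ = false

  tutte-weights : tutte (schreier n) x y ≡ sumOver (subsets E) (λ A → weight (map label A) ∅)
  tutte-weights = sumOver-cong-All _ _ (All-subsets E-path-edges) summand
    where
    summand : ∀ {A} → All IsPathEdge A →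
      X ℤ.^ (rank (schreier n) E ∸ rank (schreier n) A) ℤ.* Y ℤ.^ (length A ∸ rank (schreier n) A)
        ≡ weight (map label A) ∅
    summand {A} shapes rewrite rank-E | rank-coverage A shapes | weight-closed (map label A) (labels-below shapes) ∅
      | count<-empty m | Listₚ.length-map label A | +-identityʳ (length A) = refl

  tutte-closedForm : tutte (schreier n) x y ≡ closedForm (edgeLabels n) ∅
  tutte-closedForm = begin
    tutte (schreier n) x y
      ≡⟨ tutte-weights ⟩
    sumOver (subsets E) (λ A → weight (map label A) ∅)
      ≡⟨ sym (sumOver-map (map label) (subsets E) (λ B → weight B ∅)) ⟩
    sumOver (map (map label) (subsets E)) (λ B → weight B ∅)
      ≡⟨ cong (λ S → sumOver S (λ B → weight B ∅)) (sym (subsets-map label E)) ⟩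
    sumOver (subsets (edgeLabels n)) (λ B → weight B ∅)
      ≡⟨ subsets-weight (edgeLabels n) (labels-below E-path-edges) ∅ ⟩
    closedForm (edgeLabels n) ∅ ∎
    where open ≡-Reasoning

  t : ℕ
  t = 2 ^ k ∸ 1

  suc-t≡2^k : suc t ≡ 2 ^ k
  suc-t≡2^k = suc-∸1 (m^n>0 2 k)
    where
    suc-∸1 : ∀ {p} → 0 < p → suc (p ∸ 1) ≡ p
    suc-∸1 {suc p} _ = refl

  m≡2t+1 : m ≡ suc (t + t)
  m≡2t+1 = begin
    2 ^ k + (2 ^ k + 0) ∸ 1      ≡⟨ cong (λ P → P + (P + 0) ∸ 1) (sym suc-t≡2^k) ⟩
    suc t + (suc t + 0) ∸ 1      ≡⟨ cong (t +_) (+-identityʳ (suc t)) ⟩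
    t + suc t                    ≡⟨ +-suc t t ⟩
    suc (t + t)                  ∎
    where open ≡-Reasoning

  bundle-multiplicity : ∀ {j} → j < m → bundle (multiplicity j (edgeLabels n)) ≡ (if odd j then y ℤ.+ x else x)
  bundle-multiplicity {j} j<m rewrite edge-multiplicity k j j<m with odd j
  ... | true = two-edges x y
    where
    two-edges : ∀ x y → (x ℤ.- 1ℤ) ℤ.+ 1ℤ ℤ.+ (1ℤ ℤ.+ (y ℤ.- 1ℤ)) ℤ.* 1ℤ ≡ y ℤ.+ x
    two-edges = solve-ℤ
  ... | false = one-edge x
    where
    one-edge : ∀ x → (x ℤ.- 1ℤ) ℤ.+ 1ℤ ≡ x
    one-edge = solve-ℤ

  1+Y≡y : 1ℤ ℤ.+ Y ≡ y
  1+Y≡y = shift y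
    where
    shift : ∀ y → 1ℤ ℤ.+ (y ℤ.- 1ℤ) ≡ y
    shift = solve-ℤ

mainTheorem1 : (n : ℕ) → 1 ≤ n → (x y : ℤ) →
  tutte (schreier n) x y ≡ (y ℤ.^ (2 ^ n + 4)) ℤ.* (x ℤ.^ (2 ^ (n ∸ 1))) ℤ.* ((y ℤ.+ x) ℤ.^ (2 ^ (n ∸ 1) ∸ 1))
mainTheorem1 (suc k) _ x y = begin
  tutte (schreier n) x y
    ≡⟨ tutte-closedForm ⟩
  (1ℤ ℤ.+ Y) ℤ.^ loops (edgeLabels n) ℤ.* product< m (λ j → bundle (multiplicity j (edgeLabels n)))
    ≡⟨ cong₂ ℤ._*_ (cong₂ ℤ._^_ 1+Y≡y (edge-loops k)) (product<-cong m bundle-multiplicity) ⟩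
  y ℤ.^ (2 ^ n + 4) ℤ.* product< m (λ j → if odd j then y ℤ.+ x else x)
    ≡⟨ cong (λ M → y ℤ.^ (2 ^ n + 4) ℤ.* product< M (λ j → if odd j then y ℤ.+ x else x)) m≡2t+1 ⟩
  y ℤ.^ (2 ^ n + 4) ℤ.* product< (suc (t + t)) (λ j → if odd j then y ℤ.+ x else x)
    ≡⟨ cong (y ℤ.^ (2 ^ n + 4) ℤ.*_) (product<-alternating t x (y ℤ.+ x)) ⟩
  y ℤ.^ (2 ^ n + 4) ℤ.* (x ℤ.^ suc t ℤ.* (y ℤ.+ x) ℤ.^ t)
    ≡⟨ cong (λ e → y ℤ.^ (2 ^ n + 4) ℤ.* (x ℤ.^ e ℤ.* (y ℤ.+ x) ℤ.^ t)) suc-t≡2^k ⟩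
  y ℤ.^ (2 ^ n + 4) ℤ.* (x ℤ.^ (2 ^ k) ℤ.* (y ℤ.+ x) ℤ.^ t)
    ≡⟨ sym (ℤₚ.*-assoc (y ℤ.^ (2 ^ n + 4)) (x ℤ.^ (2 ^ k)) ((y ℤ.+ x) ℤ.^ t)) ⟩
  y ℤ.^ (2 ^ n + 4) ℤ.* x ℤ.^ (2 ^ k) ℤ.* (y ℤ.+ x) ℤ.^ t ∎
  where
  open Γ k x y
  open ≡-Reasoning
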